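{- Let $n\in\mathbb{N}$, $\pi\in S_n'$, $(i,j)\in D(\alpha_\pi)$ and $1\le k<i$. Then, regarding the sequences $B_{\pi,T_\pi}(i,j,\cdot)$ as sets of entries, \[B_{\pi,T_\pi}(i,j,k)\subseteq B_{\pi,T_\pi}(i,j,1)\] and \[B_{\pi,T_\pi}(i,j,1)\setminus B_{\pi,T_\pi}(i,j,k)\subseteq\{T_\pi^{ -1}(i',j')\mid (i',j')\in D(\alpha_\pi),\ i'<k\}.\]
   Context: A "permutation" may be any finite sequence of distinct integers. West's stack-sorting map $s$: read the input left to right with an initially empty stack; repeatedly, if the input is nonempty and either the stack is empty or the top of the stack is greater than the next input entry, push the next entry; otherwise pop the top of the stack and append it to the output; stop when input and stack are empty. $\operatorname{sc}(\pi)$ is the least $k\ge0$ with $s^k(\pi)$ increasing. $S_n'$ is the set of permutations of $\{0,1,\dots,n\}$ whose last entry is $0$. For $\pi\in S_n'$ and $1\le i\le\operatorname{sc}(\pi)$ let $\sigma=s^{i-1}(\pi)$. Let $c_{\pi,i,1}$ be the maximum of the entries of $\sigma$ strictly left of $0$; for $j\ge2$, as long as some entry of $\sigma$ lies strictly between $c_{\pi,i,j-1}$ and $0$, let $c_{\pi,i,j}$ be the maximum of those entries; otherwise stop. This gives $C_{\pi,i}=(c_{\pi,i,1},\dots,c_{\pi,i,|C_{\pi,i}|})$. Blocks: $b_{\pi,i,1}$ is the contiguous subsequence of $\sigma$ strictly before $c_{\pi,i,1}$, and $b_{\pi,i,j}$ ($j\ge2$) the contiguous subsequence strictly between $c_{\pi,i,j-1}$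 and $c_{\pi,i,j}$. Every $x\in[n]$ equals $c_{\pi,i,j}$ for a unique pair $(i,j)$; set $\operatorname{col}_\pi(x)=i$, $\operatorname{colpos}_\pi(x)=j$. If $\operatorname{col}_\pi(x)>1$, there is a unique $j$ with $x=\max(b_{\pi,\operatorname{col}_\pi(x)-1,j})$, and $\operatorname{leftof}_\pi(x):=c_{\pi,\operatorname{col}_\pi(x)-1,j}$. Recursively $\operatorname{row}_\pi(x)=\operatorname{colpos}_\pi(x)$ if $\operatorname{col}_\pi(x)=1$, and $\operatorname{row}_\pi(x)=\operatorname{row}_\pi(\operatorname{leftof}_\pi(x))$ otherwise. The composition $\alpha_\pi=(|\{x\in[n]:\operatorname{row}_\pi(x)=j\}|)_{j=1}^{|C_{\pi,1}|}$. For a composition $\alpha=(\alpha_1,\dots,\alpha_m)$, $D(\alpha)=\{(i,j)\in\mathbb{N}^2: 1\le j\le m,\ i\le\alpha_j\}$. $T_\pi:[n]\to D(\alpha_\pi)$, $T_\pi(x)=(\operatorname{col}_\pi(x),\operatorname{row}_\pi(x))$; it is a bijection. For a composition $\alpha$, a bijection $T:[n]\to D(\alpha)$, $\pi\in S_n'$, $(i,j)\in D(\alpha)$ and $1\le k<i$: let $r=\max\{j'<j:\alpha_{j'}\ge i-1\}$ (with $r=0$ if this set is empty). Define $B_{\pi,T}(i,j,k)$ to be the contiguous subsequence of $s^{k-1}(\pi)$ consisting of the entries strictly after $T^{ -1}(k,r)$ and up to and including $T^{ -1}(k,j)$ if $r>0$, and of the entries from the beginning up to and including $T^{ -1}(k,j)$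 if $r=0$. -}

module Defs where

open import Data.Nat using (ℕ; zero; suc; _∸_; _≤_; _<_; _≤ᵇ_; _<ᵇ_; _≡ᵇ_; _⊔_; _≟_)
open import Data.Nat.Properties using (_<?_)
open import Data.Bool using (Bool; true; false; if_then_else_; _∧_)
open import Data.List using (List; []; _∷_; _++_; length; map; filter; foldr; upTo)
open import Data.List.Relation.Unary.Linked using (Linked; linked?)
open import Data.List.Relation.Binary.Permutation.Propositional using (_↭_)
open import Data.Maybe using (Maybe; just; nothing)
open import Data.Product using (_×_; _,_; proj₁; proj₂; Σ)
open import Relation.Binary.PropositionalEquality using (_≡_)
open import Relation.Nullary using (does)

-- West's stack-sorting map, implemented literally as the stack machine.
-- The stack is a list whose head is the top.

popWhile : ℕ → List ℕ → List ℕ × List ℕ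
popWhile x [] = [] , []
popWhile x (t ∷ ts) with x <ᵇ t
... | true  = [] , t ∷ ts
... | false = t ∷ proj₁ (popWhile x ts) , proj₂ (popWhile x ts)

runStack : List ℕ → List ℕ → List ℕ
runStack [] st = st
runStack (x ∷ xs) st = proj₁ (popWhile x st) ++ runStack xs (x ∷ proj₂ (popWhile x st))

s : List ℕ → List ℕ
s l = runStack l []

sIter : ℕ → List ℕ → List ℕ
sIter zero l = l
sIter (suc k) l = s (sIter k l)

Increasing : List ℕ → Set
Increasing = Linked _<_

-- sc(π): least k with s^k(π) increasing.  Searched for k = 0,1,...,length π
-- (s^(m-1) sorts any sequence of length m, so the search bound suffices).
scAux : ℕ → ℕ → List ℕ → ℕ
scAux zero k l = k
scAux (suc f) k l = if does (linked? _<?_ l) then k else scAux f (suc k) (s l)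

sc : List ℕ → ℕ
sc π = scAux (length π) 0 π

InSn' : ℕ → List ℕ → Set
InSn' n π = (π ↭ upTo (suc n)) × Σ (List ℕ) (λ ρ → π ≡ ρ ++ (0 ∷ []))

beforeZero : List ℕ → List ℕ
beforeZero [] = []
beforeZero (zero ∷ l) = []
beforeZero (suc x ∷ l) = suc x ∷ beforeZero l

maxL : List ℕ → ℕ
maxL = foldr _⊔_ 0

splitAtElem : ℕ → List ℕ → List ℕ × List ℕ
splitAtElem m [] = [] , []
splitAtElem m (x ∷ l) with m ≡ᵇ x
... | true  = [] , l
... | false = x ∷ proj₁ (splitAtElem m l) , proj₂ (splitAtElem m l)

-- Given the entries P strictly left of 0: c_1 = max P, b_1 = entries before c_1;
-- then recurse on the entries strictly between c_1 and 0.  The fuel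
-- (initially length P) always suffices as the remainder strictly shrinks.
decompAux : ℕ → List ℕ → List (List ℕ × ℕ)
decompAux zero P = []
decompAux (suc f) [] = []
decompAux (suc f) (x ∷ P) =
  (proj₁ (splitAtElem (maxL (x ∷ P)) (x ∷ P)) , maxL (x ∷ P))
    ∷ decompAux f (proj₂ (splitAtElem (maxL (x ∷ P)) (x ∷ P)))

-- list of pairs (b_{π,i,j} , c_{π,i,j}) for j = 1 .. |C_{π,i}|, where σ = s^{i-1}(π)
decomp : List ℕ → ℕ → List (List ℕ × ℕ)
decomp π i = decompAux (length (beforeZero (sIter (i ∸ 1) π))) (beforeZero (sIter (i ∸ 1) π))

Cseq : List ℕ → ℕ → List ℕ
Cseq π i = map proj₂ (decomp π i)

-- 1-based position of the first occurrence
findIdx : ℕ → List ℕ → Maybe ℕ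
findIdx x [] = nothing
findIdx x (y ∷ l) with x ≡ᵇ y
... | true = just 1
... | false with findIdx x l
...   | just j = just (suc j)
...   | nothing = nothing

searchCols : List ℕ → ℕ → ℕ → ℕ → Maybe (ℕ × ℕ)
searchCols π x i zero = nothing
searchCols π x i (suc f) with findIdx x (Cseq π i)
... | just j = just (i , j)
... | nothing = searchCols π x (suc i) f

colPair : List ℕ → ℕ → Maybe (ℕ × ℕ)
colPair π x = searchCols π x 1 (sc π)

col : List ℕ → ℕ → ℕ
col π x with colPair π x
... | just p = proj₁ p
... | nothing = 0

colpos : List ℕ → ℕ → ℕ
colpos π x with colPair π x
... | just p = proj₂ p
... | nothing = 0

-- c_{π,i,j} for the j with x = max(b_{π,i,j}) (b nonempty)
findLeft : ℕ → List (List ℕ × ℕ) → ℕ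
findLeft x [] = 0
findLeft x (([] , c) ∷ r) = findLeft x r
findLeft x ((y ∷ b , c) ∷ r) = if maxL (y ∷ b) ≡ᵇ x then c else findLeft x r

leftof : List ℕ → ℕ → ℕ
leftof π x = findLeft x (decomp π (col π x ∸ 1))

-- row, by recursion on col (col(leftof x) = col x - 1, so fuel col x suffices)
rowF : List ℕ → ℕ → ℕ → ℕ
rowF π zero x = colpos π x
rowF π (suc f) x = if col π x ≤ᵇ 1 then colpos π x else rowF π f (leftof π x)

row : List ℕ → ℕ → ℕ
row π x = rowF π (col π x) x

range1 : ℕ → List ℕ
range1 n = map suc (upTo n)

-- α_π (for π ∈ S'_n), as the list (α_1, ..., α_m), m = |C_{π,1}|
alphaπ : ℕ → List ℕ → List ℕ
alphaπ n π = map (λ j → length (filter (λ x → row π x ≟ j) (range1 n))) (range1 (length (Cseq π 1)))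

-- α_j (1-based; 0 outside the range)
alphaAt : List ℕ → ℕ → ℕ
alphaAt α zero = 0
alphaAt [] (suc j) = 0
alphaAt (a ∷ α) (suc zero) = a
alphaAt (a ∷ α) (suc (suc j)) = alphaAt α (suc j)

-- (i , j) ∈ D(α)   (with ℕ = {1,2,...})
InD : List ℕ → ℕ × ℕ → Set
InD α (i , j) = (1 ≤ j) × (j ≤ length α) × (1 ≤ i) × (i ≤ alphaAt α j)

Tπ : List ℕ → ℕ → ℕ × ℕ
Tπ π x = col π x , row π x

findInv : (ℕ → ℕ × ℕ) → ℕ → ℕ → List ℕ → ℕ
findInv T a b [] = 0
findInv T a b (x ∷ l) =
  if (proj₁ (T x) ≡ᵇ a) ∧ (proj₂ (T x) ≡ᵇ b) then x else findInv T a b l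

Tinv : ℕ → (ℕ → ℕ × ℕ) → ℕ × ℕ → ℕ
Tinv n T (a , b) = findInv T a b (range1 n)

-- r = max { j' < j : α_{j'} ≥ i - 1 }, 0 if empty; called with m = j - 1
rAux : List ℕ → ℕ → ℕ → ℕ
rAux α i zero = 0
rAux α i (suc m) = if (i ∸ 1) ≤ᵇ alphaAt α (suc m) then suc m else rAux α i m

dropThrough : ℕ → List ℕ → List ℕ
dropThrough a [] = []
dropThrough a (x ∷ l) = if a ≡ᵇ x then l else dropThrough a l

takeThrough : ℕ → List ℕ → List ℕ
takeThrough b [] = []
takeThrough b (x ∷ l) = if b ≡ᵇ x then x ∷ [] else x ∷ takeThrough b l

B : List ℕ → (ℕ → ℕ × ℕ) → ℕ → List ℕ → ℕ → ℕ → ℕ → List ℕ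
B α T n π i j k =
  takeThrough (Tinv n T (k , j))
    (if rAux α i (j ∸ 1) ≡ᵇ 0
       then sIter (k ∸ 1) π
       else dropThrough (Tinv n T (k , rAux α i (j ∸ 1))) (sIter (k ∸ 1) π))

{-# OPTIONS --safe #-}
module Submission where

-- Let σ = s^c(π) and write its part left of 0 as b₁ c₁ b₂ c₂ ⋯ b_m c_m, where c₁ > c₂ > ⋯ > c_m are
-- the entries of C_{π,c+1}. Each c_j exceeds every entry between it and 0, so when the stack reaches c_j
-- it flushes exactly what is left of b_j, and 0 flushes nothing: the part of s(σ) left of 0 is
-- s(b₁) s(b₂) ⋯ s(b_m). As s(b_j) ends with max b_j, the entries of C_{π,c+2} are the maxima of the
-- nonempty blocks and leftof sends max b_j to c_j; rows are constant along leftof, so T_π⁻¹(c+2, j)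
-- is the last entry of s(b) for the block b closed by T_π⁻¹(c+1, j). Hence B(i,j,c+1) is the
-- concatenation b c ⋯ b′ c′ of a window of consecutive blocks of σ, and B(i,j,c+2) is s(b) ⋯ s(b′):
-- the latter is contained in the former and the difference consists of the separators c, …, c′,
-- which lie in column c+1 of T_π. Chaining these steps over c < k gives the theorem.

open import Defs
open import Data.Bool using (true; false; if_then_else_; _∧_)
open import Data.Bool.Properties using (T-≡; T-∧)
open import Data.Empty using (⊥-elim)
open import Data.List using (List; []; _∷_; _++_; length; map; filter; upTo; applyUpTo)
open import Data.List.Membership.Propositional using (_∈_; _∉_; find)
open import Data.List.Membership.Propositional.Properties
  using (∈-++⁺ˡ; ∈-++⁺ʳ; ∈-++⁻; ∈-∃++; ∈-map⁺; ∈-map⁻; ∈-filter⁺; ∈-filter⁻; ∈-upTo⁺; ∈-upTo⁻)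
open import Data.List.Properties
  using (++-assoc; ++-identityʳ; map-++; ∷-injectiveʳ; length-map; length-applyUpTo; map-applyUpTo)
open import Data.List.Relation.Binary.Permutation.Propositional
  using (_↭_; ↭-refl; ↭-prep; ↭-sym; ↭-trans; ↭⇒↭ₛ; module PermutationReasoning)
open import Data.List.Relation.Binary.Permutation.Propositional.Properties using (∈-resp-↭; ++⁺ˡ; ++-comm; shift)
open import Data.List.Relation.Binary.Permutation.Setoid.Properties using (Unique-resp-↭)
open import Data.List.Relation.Unary.All as All using (All; []; _∷_)
import Data.List.Relation.Unary.All.Properties as All
open import Data.List.Relation.Unary.All.Properties using (¬Any⇒All¬)
open import Data.List.Relation.Unary.Any using (here; there; any?)
open import Data.List.Relation.Unary.Unique.Propositional using (Unique; []; _∷_)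
open import Data.List.Relation.Unary.Unique.Propositional.Properties using (Unique[x∷xs]⇒x∉xs; map⁺; filter⁺; upTo⁺)
open import Data.Maybe using (just; nothing)
open import Data.Maybe.Properties using (just-injective)
open import Data.Nat
  using (ℕ; zero; suc; pred; ≢-nonZero; _+_; _∸_; _≤_; _<_; _≤ᵇ_; _<ᵇ_; _≡ᵇ_; _≟_; _≤?_; z≤n; s≤s; s≤s⁻¹; s<s⁻¹)
open import Data.Nat.Properties
open import Data.List.Membership.DecPropositional _≟_ using (_∈?_)
open import Data.Product using (_×_; _,_; proj₁; proj₂; ∃)
open import Data.Sum using (_⊎_; inj₁; inj₂)
open import Data.Unit using (⊤; tt)
open import Function.Base using (_∘_)
open import Function.Bundles using (Equivalence)
open import Relation.Binary.Definitions using (tri<; tri≈; tri>)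
open import Relation.Binary.PropositionalEquality
open import Relation.Nullary using (¬_; yes; no)

≡ᵇ-reflexive : ∀ {m n} → m ≡ n → (m ≡ᵇ n) ≡ true
≡ᵇ-reflexive {m} {n} m≡n = Equivalence.to T-≡ (≡⇒≡ᵇ m n m≡n)

≡ᵇ-false : ∀ {m n} → m ≢ n → (m ≡ᵇ n) ≡ false
≡ᵇ-false {m} {n} m≢n with m ≡ᵇ n in eq
... | false = refl
... | true  = ⊥-elim (m≢n (≡ᵇ⇒≡ m n (Equivalence.from T-≡ eq)))

≡ᵇ-true⇒≡ : ∀ {m n} → (m ≡ᵇ n) ≡ true → m ≡ n
≡ᵇ-true⇒≡ {m} {n} eq = ≡ᵇ⇒≡ m n (Equivalence.from T-≡ eq)

≡ᵇ-false⇒≢ : ∀ {m n} → (m ≡ᵇ n) ≡ false → m ≢ n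
≡ᵇ-false⇒≢ {m} eq refl with trans (sym eq) (≡ᵇ-reflexive {m} refl)
... | ()

<ᵇ-true : ∀ {m n} → m < n → (m <ᵇ n) ≡ true
<ᵇ-true m<n = Equivalence.to T-≡ (<⇒<ᵇ m<n)

<ᵇ-false : ∀ {m n} → n ≤ m → (m <ᵇ n) ≡ false
<ᵇ-false {m} {n} n≤m with m <ᵇ n in eq
... | false = refl
... | true  = ⊥-elim (<⇒≱ (<ᵇ⇒< m n (Equivalence.from T-≡ eq)) n≤m)

module _ {A : Set} where

  Unique-++⁻ˡ : ∀ xs {ys : List A} → Unique (xs ++ ys) → Unique xs
  Unique-++⁻ˡ []       _          = []
  Unique-++⁻ˡ (x ∷ xs) (x∉ ∷ uxs) = All.++⁻ˡ xs x∉ ∷ Unique-++⁻ˡ xs uxs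

  Unique-++⁻ʳ : ∀ xs {ys : List A} → Unique (xs ++ ys) → Unique ys
  Unique-++⁻ʳ []       u         = u
  Unique-++⁻ʳ (x ∷ xs) (_ ∷ uxs) = Unique-++⁻ʳ xs uxs

  Unique-++-disjoint : ∀ xs {ys : List A} {y} → Unique (xs ++ ys) → y ∈ xs → y ∉ ys
  Unique-++-disjoint (x ∷ xs) (x∉ ∷ _)  (here refl) y∈ys = All.lookup (All.++⁻ʳ xs x∉) y∈ys refl
  Unique-++-disjoint (x ∷ xs) (_ ∷ uxs) (there y∈xs) = Unique-++-disjoint xs uxs y∈xs

  Unique-∉-prefix : ∀ xs {x : A} {ys} → Unique (xs ++ x ∷ ys) → x ∉ xs
  Unique-∉-prefix xs u x∈xs = Unique-++-disjoint xs u x∈xs (here refl)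

  Unique-∉-suffix : ∀ xs {x : A} {ys} → Unique (xs ++ x ∷ ys) → x ∉ ys
  Unique-∉-suffix xs u = Unique[x∷xs]⇒x∉xs (Unique-++⁻ʳ xs u)

  Unique-∷⁻ : ∀ {x : A} {xs} → Unique (x ∷ xs) → Unique xs
  Unique-∷⁻ (_ ∷ u) = u

  ++-∷-reassoc : ∀ (xs ws : List A) {y} zs ts → (xs ++ ws ++ y ∷ zs) ++ ts ≡ (xs ++ ws) ++ y ∷ zs ++ ts
  ++-∷-reassoc xs ws {y} zs ts = begin
    (xs ++ ws ++ y ∷ zs) ++ ts ≡⟨ ++-assoc xs (ws ++ y ∷ zs) ts ⟩
    xs ++ (ws ++ y ∷ zs) ++ ts ≡⟨ cong (xs ++_) (++-assoc ws (y ∷ zs) ts) ⟩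
    xs ++ ws ++ y ∷ zs ++ ts   ≡⟨ ++-assoc xs ws (y ∷ zs ++ ts) ⟨
    (xs ++ ws) ++ y ∷ zs ++ ts ∎
    where open ≡-Reasoning

∈-++-∷⁻ : ∀ {A : Set} {y z : A} xs {ys} → y ∈ xs ++ z ∷ ys → y ≢ z → y ∈ xs ++ ys
∈-++-∷⁻ xs y∈ y≢z with ∈-++⁻ xs y∈
... | inj₁ y∈xs          = ∈-++⁺ˡ y∈xs
... | inj₂ (here y≡z)    = ⊥-elim (y≢z y≡z)
... | inj₂ (there y∈ys)  = ∈-++⁺ʳ xs y∈ys

length-++-∷ : ∀ {A : Set} (xs : List A) {z ys} → length (xs ++ z ∷ ys) ≡ suc (length (xs ++ ys))
length-++-∷ []       = refl
length-++-∷ (x ∷ xs) = cong suc (length-++-∷ xs)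

injection-length-≤ : ∀ {A B : Set} {R : A → B → Set} (U : List A) (L : List B) → Unique U →
  (∀ {u} → u ∈ U → ∃ λ v → v ∈ L × R u v) → (∀ {u u′ v} → u ∈ U → u′ ∈ U → R u v → R u′ v → u ≡ u′) →
  length U ≤ length L
injection-length-≤ []      L _        _   _      = z≤n
injection-length-≤ {R = R} (u ∷ U) L (u∉ ∷ uU) img inj with img (here refl)
... | v , v∈L , Ruv with ∈-∃++ v∈L
...   | L₁ , L₂ , refl = subst (suc (length U) ≤_) (sym (length-++-∷ L₁))
          (s≤s (injection-length-≤ U (L₁ ++ L₂) uU img′ (λ u∈ u′∈ → inj (there u∈) (there u′∈))))
  where
  img′ : ∀ {u′} → u′ ∈ U → ∃ λ v′ → v′ ∈ L₁ ++ L₂ × R u′ v′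
  img′ u′∈ with img (there u′∈)
  ... | v′ , v′∈ , Ru′v′ = v′ , ∈-++-∷⁻ L₁ v′∈ v′≢v , Ru′v′
    where
    v′≢v : v′ ≢ v
    v′≢v refl = All.lookup u∉ u′∈ (inj (here refl) (there u′∈) Ruv Ru′v′)

dropThrough-++-∷ : ∀ {u} xs {ys} → u ∉ xs → dropThrough u (xs ++ u ∷ ys) ≡ ys
dropThrough-++-∷ {u} []       _   rewrite ≡ᵇ-reflexive {u} refl = refl
dropThrough-++-∷ {u} (x ∷ xs) u∉ rewrite ≡ᵇ-false {u} {x} (u∉ ∘ here) = dropThrough-++-∷ xs (u∉ ∘ there)

takeThrough-++-∷ : ∀ {u} xs {ys} → u ∉ xs → takeThrough u (xs ++ u ∷ ys) ≡ xs ++ u ∷ []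
takeThrough-++-∷ {u} []       _   rewrite ≡ᵇ-reflexive {u} refl = refl
takeThrough-++-∷ {u} (x ∷ xs) u∉ rewrite ≡ᵇ-false {u} {x} (u∉ ∘ here) =
  cong (x ∷_) (takeThrough-++-∷ xs (u∉ ∘ there))

dropThrough-++ : ∀ {u} xs {ys} → u ∉ xs → dropThrough u (xs ++ ys) ≡ dropThrough u ys
dropThrough-++ {u} []       _   = refl
dropThrough-++ {u} (x ∷ xs) u∉ rewrite ≡ᵇ-false {u} {x} (u∉ ∘ here) = dropThrough-++ xs (u∉ ∘ there)

dropThrough-⊆ : ∀ {u v} xs → v ∈ dropThrough u xs → v ∈ xs
dropThrough-⊆ {u} (x ∷ xs) v∈ with u ≡ᵇ x
... | true  = there v∈
... | false = there (dropThrough-⊆ xs v∈)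

dropThrough-∷-self : ∀ u xs → dropThrough u (u ∷ xs) ≡ xs
dropThrough-∷-self u xs = dropThrough-++-∷ [] (λ ())

dropThrough-∷-≢ : ∀ {u x} xs → u ≢ x → dropThrough u (x ∷ xs) ≡ dropThrough u xs
dropThrough-∷-≢ xs u≢x = dropThrough-++ (_ ∷ []) (λ { (here u≡x) → u≢x u≡x })

takeThrough-at : ∀ {L} A {X B} → L ≡ A ++ X ∷ B → Unique L → takeThrough X L ≡ A ++ X ∷ []
takeThrough-at A refl u = takeThrough-++-∷ A (Unique-∉-prefix A u)

dropThrough-at : ∀ {L} A {X B} → L ≡ A ++ X ∷ B → Unique L → dropThrough X L ≡ B
dropThrough-at A refl u = dropThrough-++-∷ A (Unique-∉-prefix A u)

dropThrough-++-∈ : ∀ xs {ys x y} → Unique (xs ++ ys) → x ∈ xs → y ∈ ys → y ∈ dropThrough x (xs ++ ys)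
dropThrough-++-∈ (a ∷ xs) {ys} {y = y} _ (here refl) y∈ =
  subst (y ∈_) (sym (dropThrough-∷-self a (xs ++ ys))) (∈-++⁺ʳ xs y∈)
dropThrough-++-∈ (a ∷ xs) {ys} {y = y} u (there x∈) y∈ =
  subst (y ∈_) (sym (dropThrough-∷-≢ (xs ++ ys) λ { refl → Unique[x∷xs]⇒x∉xs u (∈-++⁺ˡ x∈) }))
    (dropThrough-++-∈ xs (Unique-∷⁻ u) x∈ y∈)

Unique-dropThrough : ∀ {u} xs → Unique xs → Unique (dropThrough u xs)
Unique-dropThrough []       _         = []
Unique-dropThrough {u} (x ∷ xs) (_ ∷ uxs) with u ≡ᵇ x
... | true  = uxs
... | false = Unique-dropThrough xs uxs

maxL-upper : ∀ {x} xs → x ∈ xs → x ≤ maxL xs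
maxL-upper (y ∷ xs) (here refl) = m≤m⊔n y (maxL xs)
maxL-upper (y ∷ xs) (there x∈)  = ≤-trans (maxL-upper xs x∈) (m≤n⊔m y (maxL xs))

maxL-∈ : ∀ x xs → maxL (x ∷ xs) ∈ x ∷ xs
maxL-∈ x []       = here (⊔-identityʳ x)
maxL-∈ x (y ∷ xs) with ⊔-sel x (maxL (y ∷ xs))
... | inj₁ eq = here eq
... | inj₂ eq = there (subst (_∈ y ∷ xs) (sym eq) (maxL-∈ y xs))

splitAtElem-∈ : ∀ m xs → m ∈ xs → xs ≡ proj₁ (splitAtElem m xs) ++ m ∷ proj₂ (splitAtElem m xs)
splitAtElem-∈ m (x ∷ xs) m∈ with m ≡ᵇ x in eq | m∈
... | true  | _          = cong (_∷ xs) (sym (≡ᵇ-true⇒≡ eq))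
... | false | here m≡x   = ⊥-elim (≡ᵇ-false⇒≢ eq m≡x)
... | false | there m∈xs = cong (x ∷_) (splitAtElem-∈ m xs m∈xs)

length-suffix< : ∀ xs {m : ℕ} ys → length ys < length (xs ++ m ∷ ys)
length-suffix< []       ys = ≤-refl
length-suffix< (x ∷ xs) ys = m≤n⇒m≤1+n (length-suffix< xs ys)

module SplitAtMax (x : ℕ) (xs : List ℕ) (u : Unique (x ∷ xs)) where

  m : ℕ
  m = maxL (x ∷ xs)

  before after : List ℕ
  before = proj₁ (splitAtElem m (x ∷ xs))
  after  = proj₂ (splitAtElem m (x ∷ xs))

  split : x ∷ xs ≡ before ++ m ∷ after
  split = splitAtElem-∈ m (x ∷ xs) (maxL-∈ x xs)

  unique-split : Unique (before ++ m ∷ after)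
  unique-split = subst Unique split u

  unique-after : Unique after
  unique-after = Unique-∷⁻ (Unique-++⁻ʳ before unique-split)

  before-⊆ : ∀ {y} → y ∈ before → y ∈ x ∷ xs
  before-⊆ y∈ = subst (_ ∈_) (sym split) (∈-++⁺ˡ y∈)

  after-⊆ : ∀ {y} → y ∈ after → y ∈ x ∷ xs
  after-⊆ y∈ = subst (_ ∈_) (sym split) (∈-++⁺ʳ before (there y∈))

  before<m : All (_< m) before
  before<m = All.tabulate λ y∈ →
    ≤∧≢⇒< (maxL-upper (x ∷ xs) (before-⊆ y∈)) λ { refl → Unique-∉-prefix before unique-split y∈ }

  after<m : All (_< m) after
  after<m = All.tabulate λ y∈ →
    ≤∧≢⇒< (maxL-upper (x ∷ xs) (after-⊆ y∈)) λ { refl → Unique-∉-suffix before unique-split y∈ }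

  after-shorter : ∀ {f} → length (x ∷ xs) ≤ suc f → length after ≤ f
  after-shorter le = s≤s⁻¹ (≤-trans (length-suffix< before after) (≤-trans (≤-reflexive (cong length (sym split))) le))

range1-∈⁺ : ∀ m {x} → 1 ≤ x → x ≤ m → x ∈ range1 m
range1-∈⁺ m {suc x} _ x≤m = ∈-map⁺ suc (∈-upTo⁺ x≤m)

range1-∈⁻ : ∀ m {x} → x ∈ range1 m → 1 ≤ x × x ≤ m
range1-∈⁻ m x∈ with ∈-map⁻ suc x∈
... | _ , y∈ , refl = s≤s z≤n , ∈-upTo⁻ y∈

Unique-range1 : ∀ m → Unique (range1 m)
Unique-range1 m = map⁺ suc-injective (upTo⁺ m)

length-range1 : ∀ m → length (range1 m) ≡ m
length-range1 m = trans (length-map suc (upTo m)) (length-applyUpTo (λ x → x) m)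

alphaAt-applyUpTo : ∀ (g : ℕ → ℕ) m t → t < m → alphaAt (applyUpTo g m) (suc t) ≡ g t
alphaAt-applyUpTo g (suc m) zero    _   = refl
alphaAt-applyUpTo g (suc m) (suc t) t<m = alphaAt-applyUpTo (g ∘ suc) m t (s<s⁻¹ t<m)

alphaAt-map-range1 : ∀ (g : ℕ → ℕ) m j → 1 ≤ j → j ≤ m → alphaAt (map g (range1 m)) j ≡ g j
alphaAt-map-range1 g m (suc t) _ j≤m = begin
  alphaAt (map g (map suc (upTo m))) (suc t) ≡⟨ cong (λ l → alphaAt (map g l) (suc t)) (map-applyUpTo (λ x → x) suc m) ⟩
  alphaAt (map g (applyUpTo suc m)) (suc t)  ≡⟨ cong (λ l → alphaAt l (suc t)) (map-applyUpTo suc g m) ⟩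
  alphaAt (applyUpTo (g ∘ suc) m) (suc t)    ≡⟨ alphaAt-applyUpTo (g ∘ suc) m t j≤m ⟩
  g (suc t)                                  ∎
  where open ≡-Reasoning

rAux-spec : ∀ α i m → rAux α i m ≡ 0 ⊎ (1 ≤ rAux α i m × rAux α i m ≤ m × i ∸ 1 ≤ alphaAt α (rAux α i m))
rAux-spec α i zero = inj₁ refl
rAux-spec α i (suc m) with (i ∸ 1) ≤ᵇ alphaAt α (suc m) in fits
... | true  = inj₂ (s≤s z≤n , ≤-refl , ≤ᵇ⇒≤ _ _ (Equivalence.from T-≡ fits))
... | false with rAux-spec α i m
...   | inj₁ r≡0               = inj₁ r≡0
...   | inj₂ (1≤r , r≤m , fit) = inj₂ (1≤r , m≤n⇒m≤1+n r≤m , fit)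

findIdx-∷ : ∀ {x y L p} → findIdx x (y ∷ L) ≡ just p →
  (x ≡ y × p ≡ 1) ⊎ (x ≢ y × ∃ λ q → findIdx x L ≡ just q × p ≡ suc q)
findIdx-∷ {x} {y} {L} e with x ≡ᵇ y in x≡ᵇy
... | true = inj₁ (≡ᵇ-true⇒≡ x≡ᵇy , sym (just-injective e))
... | false with findIdx x L
...   | just q = inj₂ (≡ᵇ-false⇒≢ x≡ᵇy , q , refl , sym (just-injective e))
findIdx-∷ () | false | nothing

findIdx-∈ : ∀ {x} L {p} → findIdx x L ≡ just p → x ∈ L
findIdx-∈ {x} (y ∷ L) e with findIdx-∷ {x} {y} {L} e
... | inj₁ (refl , _)         = here refl
... | inj₂ (_ , _ , e′ , _)   = there (findIdx-∈ L e′)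

findIdx-complete : ∀ {x} L → x ∈ L → ∃ λ p → findIdx x L ≡ just p
findIdx-complete {x} (y ∷ L) x∈ with x ≡ᵇ y in x≡ᵇy
... | true = 1 , refl
... | false with findIdx x L in e | x∈
...   | just q  | _          = suc q , refl
...   | nothing | here x≡y   = ⊥-elim (≡ᵇ-false⇒≢ x≡ᵇy x≡y)
...   | nothing | there x∈L with trans (sym e) (proj₂ (findIdx-complete L x∈L))
...     | ()

findIdx-range : ∀ {x} L {p} → findIdx x L ≡ just p → 1 ≤ p × p ≤ length L
findIdx-range {x} (y ∷ L) e with findIdx-∷ {x} {y} {L} e
... | inj₁ (_ , refl)          = ≤-refl , s≤s z≤n
... | inj₂ (_ , _ , e′ , refl) = s≤s z≤n , s≤s (proj₂ (findIdx-range L e′))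

findIdx-injective : ∀ {x x′} L {p} → findIdx x L ≡ just p → findIdx x′ L ≡ just p → x ≡ x′
findIdx-injective {x} {x′} (y ∷ L) e e′ with findIdx-∷ {x} {y} {L} e | findIdx-∷ {x′} {y} {L} e′
... | inj₁ (refl , _)            | inj₁ (refl , _)             = refl
... | inj₁ (_ , refl)            | inj₂ (_ , _ , e″ , refl)    with () ← proj₁ (findIdx-range L e″)
... | inj₂ (_ , _ , e″ , refl)   | inj₁ (_ , refl)             with () ← proj₁ (findIdx-range L e″)
... | inj₂ (_ , _ , e₁ , refl)   | inj₂ (_ , _ , e₂ , refl)    = findIdx-injective L e₁ e₂

findIdx-< : ∀ {x x′} L {p p′} → findIdx x L ≡ just p → findIdx x′ L ≡ just p′ → p < p′ → x′ ∈ dropThrough x L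
findIdx-< {x} {x′} (y ∷ L) e e′ p<p′ with findIdx-∷ {x} {y} {L} e | findIdx-∷ {x′} {y} {L} e′
... | inj₁ (refl , refl)         | inj₁ (_ , refl)             = ⊥-elim (<-irrefl refl p<p′)
... | inj₁ (refl , refl)         | inj₂ (_ , _ , e″ , refl)    =
  subst (_ ∈_) (sym (dropThrough-∷-self y L)) (findIdx-∈ L e″)
... | inj₂ (_ , _ , _ , refl)    | inj₁ (_ , refl)             = ⊥-elim (<⇒≱ p<p′ (s≤s z≤n))
... | inj₂ (x≢y , _ , e₁ , refl) | inj₂ (_ , _ , e₂ , refl)    =
  subst (_ ∈_) (sym (dropThrough-∷-≢ L x≢y)) (findIdx-< L e₁ e₂ (s<s⁻¹ p<p′))

-- Stack sorting

_<Top_ : ℕ → List ℕ → Set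
x <Top []      = ⊤
x <Top (t ∷ _) = x < t

<Top-trans : ∀ {x c} st → x < c → c <Top st → x <Top st
<Top-trans []      _   _   = tt
<Top-trans (t ∷ _) x<c c<t = <-trans x<c c<t

popWhile-++ : ∀ x st₁ st₂ → x <Top st₂ →
  popWhile x (st₁ ++ st₂) ≡ (proj₁ (popWhile x st₁) , proj₂ (popWhile x st₁) ++ st₂)
popWhile-++ x []        []        _   = refl
popWhile-++ x []        (t ∷ st₂) x<t rewrite <ᵇ-true x<t = refl
popWhile-++ x (t ∷ st₁) st₂       x<  with x <ᵇ t
... | true  = refl
... | false rewrite popWhile-++ x st₁ st₂ x< = refl

popWhile-all : ∀ c st → All (_< c) st → popWhile c st ≡ (st , [])
popWhile-all c []       _          = refl
popWhile-all c (t ∷ st) (t<c ∷ <c) rewrite <ᵇ-false (<⇒≤ t<c) | popWhile-all c st <c = refl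

popWhile-kept-⊆ : ∀ {y} x st → y ∈ proj₂ (popWhile x st) → y ∈ st
popWhile-kept-⊆ x (t ∷ st) y∈ with x <ᵇ t
... | true  = y∈
... | false = there (popWhile-kept-⊆ x st y∈)

popWhile-++-split : ∀ x st → proj₁ (popWhile x st) ++ proj₂ (popWhile x st) ≡ st
popWhile-++-split x []       = refl
popWhile-++-split x (t ∷ st) with x <ᵇ t
... | true  = refl
... | false = cong (t ∷_) (popWhile-++-split x st)

runStack-flush : ∀ b {c L} st₁ st → All (_< c) b → All (_< c) st₁ → c <Top st →
  runStack (b ++ c ∷ L) (st₁ ++ st) ≡ runStack b st₁ ++ runStack L (c ∷ st)
runStack-flush [] {c} st₁ st _ st₁<c c< rewrite popWhile-++ c st₁ st c< | popWhile-all c st₁ st₁<c = refl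
runStack-flush (x ∷ b) {c} {L} st₁ st (x<c ∷ b<c) st₁<c c<
  rewrite popWhile-++ x st₁ st (<Top-trans st x<c c<)
        | runStack-flush b {c} {L} (x ∷ proj₂ (popWhile x st₁)) st b<c
            (x<c ∷ All.anti-mono (popWhile-kept-⊆ x st₁) st₁<c) c<
  = sym (++-assoc (proj₁ (popWhile x st₁)) _ _)

runStack-bottom-last : ∀ xs {m} st → All (_< m) xs → All (_< m) st →
  ∃ λ w → runStack xs (st ++ m ∷ []) ≡ w ++ m ∷ []
runStack-bottom-last []       st _ _ = st , refl
runStack-bottom-last (x ∷ xs) {m} st (x<m ∷ xs<m) st<m rewrite popWhile-++ x st (m ∷ []) x<m
  with runStack-bottom-last xs {m} (x ∷ proj₂ (popWhile x st)) xs<m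
         (x<m ∷ All.anti-mono (popWhile-kept-⊆ x st) st<m)
... | w , eq rewrite eq = proj₁ (popWhile x st) ++ w , sym (++-assoc (proj₁ (popWhile x st)) w _)

s-ends-with-max : ∀ x xs → Unique (x ∷ xs) → ∃ λ w → s (x ∷ xs) ≡ w ++ maxL (x ∷ xs) ∷ []
s-ends-with-max x xs u =
  let (w , eqw) = runStack-bottom-last after [] after<m [] in
  runStack before [] ++ w , (begin
    runStack (x ∷ xs) []                          ≡⟨ cong (λ l → runStack l []) split ⟩
    runStack (before ++ m ∷ after) []             ≡⟨ runStack-flush before [] [] before<m [] tt ⟩
    runStack before [] ++ runStack after (m ∷ []) ≡⟨ cong (runStack before [] ++_) eqw ⟩
    runStack before [] ++ w ++ m ∷ []             ≡⟨ ++-assoc (runStack before []) w _ ⟨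
    (runStack before [] ++ w) ++ m ∷ []           ∎)
  where
  open SplitAtMax x xs u
  open ≡-Reasoning

runStack-↭ : ∀ xs st → runStack xs st ↭ xs ++ st
runStack-↭ []       st = ↭-refl
runStack-↭ (x ∷ xs) st = begin
  popped ++ runStack xs (x ∷ kept)  ↭⟨ ++⁺ˡ popped (runStack-↭ xs (x ∷ kept)) ⟩
  popped ++ xs ++ x ∷ kept          ↭⟨ ++-comm popped (xs ++ x ∷ kept) ⟩
  (xs ++ x ∷ kept) ++ popped        ≡⟨ ++-assoc xs (x ∷ kept) popped ⟩
  xs ++ x ∷ kept ++ popped          ↭⟨ shift x xs (kept ++ popped) ⟩
  x ∷ xs ++ kept ++ popped          ↭⟨ ↭-prep x (++⁺ˡ xs (++-comm kept popped)) ⟩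
  x ∷ xs ++ popped ++ kept          ≡⟨ cong (λ l → x ∷ xs ++ l) (popWhile-++-split x st) ⟩
  x ∷ xs ++ st                      ∎
  where
  open PermutationReasoning
  popped kept : List ℕ
  popped = proj₁ (popWhile x st)
  kept = proj₂ (popWhile x st)

s-↭ : ∀ xs → s xs ↭ xs
s-↭ xs = subst (s xs ↭_) (++-identityʳ xs) (runStack-↭ xs [])

s-∈⁻ : ∀ {y} xs → y ∈ s xs → y ∈ xs
s-∈⁻ xs = ∈-resp-↭ (s-↭ xs)

s-∈⁺ : ∀ {y} xs → y ∈ xs → y ∈ s xs
s-∈⁺ xs = ∈-resp-↭ (↭-sym (s-↭ xs))

ends-∈ : ∀ {xs : List ℕ} {x} → (∃ λ w → xs ≡ w ++ x ∷ []) → x ∈ xs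
ends-∈ (w , xs≡) = subst (_ ∈_) (sym xs≡) (∈-++⁺ʳ w (here refl))

s-block-ends-with : ∀ b {x} → Unique b → (∃ λ z → ∃ λ bb → b ≡ z ∷ bb × maxL b ≡ x) → ∃ λ w → s b ≡ w ++ x ∷ []
s-block-ends-with b u (z , bb , refl , refl) = s-ends-with-max z bb u

afterZero : List ℕ → List ℕ
afterZero []          = []
afterZero (zero ∷ l)  = l
afterZero (suc _ ∷ l) = afterZero l

beforeZero-afterZero : ∀ xs → 0 ∈ xs → xs ≡ beforeZero xs ++ 0 ∷ afterZero xs
beforeZero-afterZero (zero ∷ xs)  _          = refl
beforeZero-afterZero (suc x ∷ xs) (there 0∈) = cong (suc x ∷_) (beforeZero-afterZero xs 0∈)

beforeZero-positive : ∀ xs → All (0 <_) (beforeZero xs)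
beforeZero-positive []           = []
beforeZero-positive (zero ∷ xs)  = []
beforeZero-positive (suc x ∷ xs) = s≤s z≤n ∷ beforeZero-positive xs

beforeZero-⊆ : ∀ xs {y} → y ∈ beforeZero xs → y ∈ xs
beforeZero-⊆ (suc x ∷ xs) (here refl) = here refl
beforeZero-⊆ (suc x ∷ xs) (there y∈) = there (beforeZero-⊆ xs y∈)

beforeZero-++ : ∀ xs {ys} → All (0 <_) xs → beforeZero (xs ++ ys) ≡ xs ++ beforeZero ys
beforeZero-++ []           _          = refl
beforeZero-++ (suc x ∷ xs) (_ ∷ xs>0) = cong (suc x ∷_) (beforeZero-++ xs xs>0)

beforeZero-runStack-0 : ∀ Q st → 0 <Top st → beforeZero (runStack (0 ∷ Q) st) ≡ []
beforeZero-runStack-0 Q st 0<st rewrite popWhile-++ 0 [] st 0<st = zero-on-top Q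
  where
  -- nothing read next is smaller than 0, so 0 is popped first
  zero-on-top : ∀ Q → beforeZero (runStack Q (0 ∷ st)) ≡ []
  zero-on-top []      = refl
  zero-on-top (q ∷ Q) = refl

-- Block decompositions

-- [(b₁ , c₁) , … , (b_m , c_m)] stands for b₁ c₁ ⋯ b_m c_m; decomp π i lists the pairs (b_{π,i,j} , c_{π,i,j}).
Blocks : Set
Blocks = List (List ℕ × ℕ)

flatten : Blocks → List ℕ
flatten []            = []
flatten ((b , c) ∷ D) = b ++ c ∷ flatten D

sortBlocks : Blocks → List ℕ
sortBlocks []            = []
sortBlocks ((b , _) ∷ D) = s b ++ sortBlocks D

separators : Blocks → List ℕ
separators = map proj₂

flatten-++ : ∀ D₁ D₂ → flatten (D₁ ++ D₂) ≡ flatten D₁ ++ flatten D₂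
flatten-++ []             D₂ = refl
flatten-++ ((b , c) ∷ D₁) D₂ =
  trans (cong (λ l → b ++ c ∷ l) (flatten-++ D₁ D₂)) (sym (++-assoc b (c ∷ flatten D₁) (flatten D₂)))

sortBlocks-++ : ∀ D₁ D₂ → sortBlocks (D₁ ++ D₂) ≡ sortBlocks D₁ ++ sortBlocks D₂
sortBlocks-++ []             D₂ = refl
sortBlocks-++ ((b , c) ∷ D₁) D₂ =
  trans (cong (s b ++_) (sortBlocks-++ D₁ D₂)) (sym (++-assoc (s b) (sortBlocks D₁) (sortBlocks D₂)))

∈-separators-middle : ∀ D₁ b c D₂ → c ∈ separators (D₁ ++ (b , c) ∷ D₂)
∈-separators-middle D₁ b c D₂ =
  subst (c ∈_) (sym (map-++ proj₂ D₁ ((b , c) ∷ D₂))) (∈-++⁺ʳ (separators D₁) (here refl))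

∈-sortBlocks-middle : ∀ D₁ b c D₂ {y} → y ∈ s b → y ∈ sortBlocks (D₁ ++ (b , c) ∷ D₂)
∈-sortBlocks-middle D₁ b c D₂ y∈ =
  subst (_ ∈_) (sym (sortBlocks-++ D₁ ((b , c) ∷ D₂))) (∈-++⁺ʳ (sortBlocks D₁) (∈-++⁺ˡ y∈))

separators-⊆-flatten : ∀ D {y} → y ∈ separators D → y ∈ flatten D
separators-⊆-flatten ((b , c) ∷ D) (here refl) = ∈-++⁺ʳ b (here refl)
separators-⊆-flatten ((b , c) ∷ D) (there y∈)  = ∈-++⁺ʳ b (there (separators-⊆-flatten D y∈))

sortBlocks-⊆-flatten : ∀ D {y} → y ∈ sortBlocks D → y ∈ flatten D
sortBlocks-⊆-flatten ((b , c) ∷ D) y∈ with ∈-++⁻ (s b) y∈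
... | inj₁ y∈sb = ∈-++⁺ˡ (s-∈⁻ b y∈sb)
... | inj₂ y∈D  = ∈-++⁺ʳ b (there (sortBlocks-⊆-flatten D y∈D))

flatten-∖-sortBlocks : ∀ D {y} → y ∈ flatten D → y ∉ sortBlocks D → y ∈ separators D
flatten-∖-sortBlocks ((b , c) ∷ D) y∈ y∉ with ∈-++⁻ b y∈
... | inj₁ y∈b           = ⊥-elim (y∉ (∈-++⁺ˡ (s-∈⁺ b y∈b)))
... | inj₂ (here refl)   = here refl
... | inj₂ (there y∈D)   = there (flatten-∖-sortBlocks D y∈D (y∉ ∘ ∈-++⁺ʳ (s b)))

separators-∉-sortBlocks : ∀ D {y} → Unique (flatten D) → y ∈ separators D → y ∉ sortBlocks D
separators-∉-sortBlocks ((b , c) ∷ D) u y∈ y∈sD with y∈ | ∈-++⁻ (s b) y∈sD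
... | here refl | inj₁ y∈sb = Unique-∉-prefix b u (s-∈⁻ b y∈sb)
... | here refl | inj₂ y∈D  = Unique-∉-suffix b u (sortBlocks-⊆-flatten D y∈D)
... | there y∈′ | inj₁ y∈sb = Unique-++-disjoint b u (s-∈⁻ b y∈sb) (there (separators-⊆-flatten D y∈′))
... | there y∈′ | inj₂ y∈D  = separators-∉-sortBlocks D (Unique-∷⁻ (Unique-++⁻ʳ b u)) y∈′ y∈D

Unique-separators : ∀ D → Unique (flatten D) → Unique (separators D)
Unique-separators []            _ = []
Unique-separators ((b , c) ∷ D) u =
  All.tabulate (λ y∈ → λ { refl → Unique-∉-suffix b u (separators-⊆-flatten D y∈) })
  ∷ Unique-separators D (Unique-∷⁻ (Unique-++⁻ʳ b u))

Unique-block : ∀ D₁ b y D₂ → Unique (flatten (D₁ ++ (b , y) ∷ D₂)) → Unique b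
Unique-block D₁ b y D₂ u = Unique-++⁻ˡ b (Unique-++⁻ʳ (flatten D₁) (subst Unique (flatten-++ D₁ ((b , y) ∷ D₂)) u))

∈-sortBlocks⁻ : ∀ D {y} → y ∈ sortBlocks D →
  ∃ λ D₁ → ∃ λ b → ∃ λ c → ∃ λ D₂ → (D ≡ D₁ ++ (b , c) ∷ D₂) × y ∈ s b
∈-sortBlocks⁻ ((b , c) ∷ D) y∈ with ∈-++⁻ (s b) y∈
... | inj₁ y∈sb = [] , b , c , D , refl , y∈sb
... | inj₂ y∈D  = let (D₁ , b′ , c′ , D₂ , eq , y∈sb′) = ∈-sortBlocks⁻ D y∈D
                  in (b , c) ∷ D₁ , b′ , c′ , D₂ , cong ((b , c) ∷_) eq , y∈sb′

∈-separators⁻ : ∀ D {y} → y ∈ separators D → ∃ λ D₁ → ∃ λ b → ∃ λ D₂ → D ≡ D₁ ++ (b , y) ∷ D₂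
∈-separators⁻ ((b , c) ∷ D) (here refl) = [] , b , D , refl
∈-separators⁻ ((b , c) ∷ D) (there y∈)  =
  let (D₁ , b′ , D₂ , eq) = ∈-separators⁻ D y∈ in (b , c) ∷ D₁ , b′ , D₂ , cong ((b , c) ∷_) eq

block-unique : ∀ D₁ D₁′ {b b′ y D₂ D₂′} → Unique (flatten (D₁ ++ (b , y) ∷ D₂)) →
  D₁ ++ (b , y) ∷ D₂ ≡ D₁′ ++ (b′ , y) ∷ D₂′ → b ≡ b′
block-unique []             []               _ refl = refl
block-unique []             ((b₀ , c₀) ∷ D₁′) {b} {b′} {y} {D₂} {D₂′} u refl =
  ⊥-elim (Unique-∉-suffix b u (subst (y ∈_) (sym (flatten-++ D₁′ ((b′ , y) ∷ D₂′)))
    (∈-++⁺ʳ (flatten D₁′) (∈-++⁺ʳ b′ (here refl)))))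
block-unique ((b₀ , c₀) ∷ D₁) []               {b} {b′} {y} {D₂} {D₂′} u refl =
  ⊥-elim (Unique-∉-suffix b′ u (subst (y ∈_) (sym (flatten-++ D₁ ((b , y) ∷ D₂)))
    (∈-++⁺ʳ (flatten D₁) (∈-++⁺ʳ b (here refl)))))
block-unique ((b₀ , c₀) ∷ D₁) ((b₀′ , c₀′) ∷ D₁′) u eq =
  block-unique D₁ D₁′ (Unique-∷⁻ (Unique-++⁻ʳ b₀ u)) (∷-injectiveʳ eq)

separators-window-⊆ : ∀ E M b X F {y} → y ∈ separators (M ++ (b , X) ∷ []) → y ∈ separators (E ++ M ++ (b , X) ∷ F)
separators-window-⊆ E M b X F y∈ =
  subst (_ ∈_) (sym (map-++ proj₂ E (M ++ (b , X) ∷ F))) (∈-++⁺ʳ (separators E)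
    (subst (_ ∈_) (sym (map-++ proj₂ M ((b , X) ∷ F))) (window (subst (_ ∈_) (map-++ proj₂ M ((b , X) ∷ [])) y∈))))
  where
  window : ∀ {y} → y ∈ separators M ++ X ∷ [] → y ∈ separators M ++ X ∷ separators F
  window y∈ with ∈-++⁻ (separators M) y∈
  ... | inj₁ y∈M        = ∈-++⁺ˡ y∈M
  ... | inj₂ (here y≡X) = ∈-++⁺ʳ (separators M) (here y≡X)

separator-∉-block : ∀ b c D {u} → Unique (flatten ((b , c) ∷ D)) → u ∈ separators ((b , c) ∷ D) → u ∉ b
separator-∉-block b c D u (here refl) = Unique-∉-prefix b u
separator-∉-block b c D u (there u∈D) u∈b = Unique-++-disjoint b u u∈b (there (separators-⊆-flatten D u∈D))

later-separator-≢ : ∀ b c D {u} → Unique (flatten ((b , c) ∷ D)) → u ∈ separators D → u ≢ c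
later-separator-≢ b c D uD u∈D refl = Unique-∉-suffix b uD (separators-⊆-flatten D u∈D)

separators-order⁻ : ∀ D {y y′} → Unique (flatten D) → y ∈ separators D → y′ ∈ dropThrough y (separators D) →
  ∃ λ E₁ → ∃ λ b → ∃ λ M → ∃ λ b′ → ∃ λ E₂ → D ≡ E₁ ++ (b , y) ∷ M ++ (b′ , y′) ∷ E₂
separators-order⁻ D {y} {y′} u y∈ y′∈ with ∈-separators⁻ D y∈
... | D₁ , b , D₂ , refl with ∈-separators⁻ D₂ {y′} (subst (y′ ∈_) after-y y′∈)
  where
  split : separators (D₁ ++ (b , y) ∷ D₂) ≡ separators D₁ ++ y ∷ separators D₂
  split = map-++ proj₂ D₁ ((b , y) ∷ D₂)
  after-y : dropThrough y (separators (D₁ ++ (b , y) ∷ D₂)) ≡ separators D₂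
  after-y = trans (cong (dropThrough y) split)
    (dropThrough-++-∷ (separators D₁) (Unique-∉-prefix (separators D₁)
      (subst Unique split (Unique-separators (D₁ ++ (b , y) ∷ D₂) u))))
...   | M , b′ , E₂ , refl = D₁ , b , M , b′ , E₂ , refl

separators-order⁺ : ∀ D {u v} → Unique (flatten D) → u ∈ separators D → v ∈ separators D →
  v ∈ dropThrough u (flatten D) → v ∈ dropThrough u (separators D)
separators-order⁺ ((b , c) ∷ D) {u} {v} uD u∈ v∈ v∈drop =
  go u∈ v∈ (subst (v ∈_) (dropThrough-++ b (separator-∉-block b c D uD u∈)) v∈drop)
  where
  uD′ : Unique (flatten D)
  uD′ = Unique-∷⁻ (Unique-++⁻ʳ b uD)
  go : u ∈ separators ((b , c) ∷ D) → v ∈ separators ((b , c) ∷ D) → v ∈ dropThrough u (c ∷ flatten D) →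
       v ∈ dropThrough u (c ∷ separators D)
  go (here refl) (here refl) v∈drop′ =
    ⊥-elim (Unique-∉-suffix b uD (subst (v ∈_) (dropThrough-∷-self u (flatten D)) v∈drop′))
  go (here refl) (there v∈D) _ = subst (v ∈_) (sym (dropThrough-∷-self u (separators D))) v∈D
  go (there u∈D) (here refl) v∈drop′ =
    ⊥-elim (Unique-∉-suffix b uD (dropThrough-⊆ (flatten D)
      (subst (v ∈_) (dropThrough-∷-≢ _ (later-separator-≢ b c D uD u∈D)) v∈drop′)))
  go (there u∈D) (there v∈D) v∈drop′ =
    subst (v ∈_) (sym (dropThrough-∷-≢ _ u≢c))
      (separators-order⁺ D uD′ u∈D v∈D (subst (v ∈_) (dropThrough-∷-≢ _ u≢c) v∈drop′))
    where
    u≢c : u ≢ c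
    u≢c = later-separator-≢ b c D uD u∈D

flatten-around : ∀ D₁ b X D₂ T → flatten (D₁ ++ (b , X) ∷ D₂) ++ T ≡ (flatten D₁ ++ b) ++ X ∷ flatten D₂ ++ T
flatten-around D₁ b X D₂ T =
  trans (cong (_++ T) (flatten-++ D₁ ((b , X) ∷ D₂))) (++-∷-reassoc (flatten D₁) b (flatten D₂) T)

sortBlocks-around : ∀ D₁ b X D₂ T {w Y} → s b ≡ w ++ Y ∷ [] →
  sortBlocks (D₁ ++ (b , X) ∷ D₂) ++ T ≡ (sortBlocks D₁ ++ w) ++ Y ∷ sortBlocks D₂ ++ T
sortBlocks-around D₁ b X D₂ T {w} {Y} sb≡ = begin
  sortBlocks (D₁ ++ (b , X) ∷ D₂) ++ T                    ≡⟨ cong (_++ T) (sortBlocks-++ D₁ ((b , X) ∷ D₂)) ⟩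
  (sortBlocks D₁ ++ s b ++ sortBlocks D₂) ++ T            ≡⟨ cong (λ l → (sortBlocks D₁ ++ l) ++ T) s-block≡ ⟩
  (sortBlocks D₁ ++ w ++ Y ∷ sortBlocks D₂) ++ T          ≡⟨ ++-∷-reassoc (sortBlocks D₁) w (sortBlocks D₂) T ⟩
  (sortBlocks D₁ ++ w) ++ Y ∷ sortBlocks D₂ ++ T          ∎
  where
  open ≡-Reasoning
  s-block≡ : s b ++ sortBlocks D₂ ≡ w ++ Y ∷ sortBlocks D₂
  s-block≡ = trans (cong (_++ sortBlocks D₂) sb≡) (++-assoc w (Y ∷ []) (sortBlocks D₂))

takeThrough-flatten : ∀ D₁ b X D₂ T → Unique (flatten (D₁ ++ (b , X) ∷ D₂) ++ T) →
  takeThrough X (flatten (D₁ ++ (b , X) ∷ D₂) ++ T) ≡ flatten (D₁ ++ (b , X) ∷ [])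
takeThrough-flatten D₁ b X D₂ T u = begin
  takeThrough X (flatten (D₁ ++ (b , X) ∷ D₂) ++ T) ≡⟨ takeThrough-at (flatten D₁ ++ b) (flatten-around D₁ b X D₂ T) u ⟩
  (flatten D₁ ++ b) ++ X ∷ []                        ≡⟨ flatten-around D₁ b X [] [] ⟨
  flatten (D₁ ++ (b , X) ∷ []) ++ []                 ≡⟨ ++-identityʳ _ ⟩
  flatten (D₁ ++ (b , X) ∷ [])                       ∎
  where open ≡-Reasoning

dropThrough-flatten : ∀ D₁ b X D₂ T → Unique (flatten (D₁ ++ (b , X) ∷ D₂) ++ T) →
  dropThrough X (flatten (D₁ ++ (b , X) ∷ D₂) ++ T) ≡ flatten D₂ ++ T
dropThrough-flatten D₁ b X D₂ T = dropThrough-at (flatten D₁ ++ b) (flatten-around D₁ b X D₂ T)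

takeThrough-sortBlocks : ∀ D₁ b X D₂ T {w Y} → s b ≡ w ++ Y ∷ [] → Unique (sortBlocks (D₁ ++ (b , X) ∷ D₂) ++ T) →
  takeThrough Y (sortBlocks (D₁ ++ (b , X) ∷ D₂) ++ T) ≡ sortBlocks (D₁ ++ (b , X) ∷ [])
takeThrough-sortBlocks D₁ b X D₂ T {w} {Y} sb≡ u = begin
  takeThrough Y (sortBlocks (D₁ ++ (b , X) ∷ D₂) ++ T) ≡⟨ takeThrough-at (sortBlocks D₁ ++ w) (sortBlocks-around D₁ b X D₂ T sb≡) u ⟩
  (sortBlocks D₁ ++ w) ++ Y ∷ []                       ≡⟨ sortBlocks-around D₁ b X [] [] sb≡ ⟨
  sortBlocks (D₁ ++ (b , X) ∷ []) ++ []                ≡⟨ ++-identityʳ _ ⟩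
  sortBlocks (D₁ ++ (b , X) ∷ [])                      ∎
  where open ≡-Reasoning

dropThrough-sortBlocks : ∀ D₁ b X D₂ T {w Y} → s b ≡ w ++ Y ∷ [] → Unique (sortBlocks (D₁ ++ (b , X) ∷ D₂) ++ T) →
  dropThrough Y (sortBlocks (D₁ ++ (b , X) ∷ D₂) ++ T) ≡ sortBlocks D₂ ++ T
dropThrough-sortBlocks D₁ b X D₂ T {w} sb≡ = dropThrough-at (sortBlocks D₁ ++ w) (sortBlocks-around D₁ b X D₂ T sb≡)

-- s b ends with max b, which would otherwise be an entry after x that is at least x.
dominant-∈-s⇒max : ∀ D₁ z bb y D₂ {x} → Unique (sortBlocks (D₁ ++ (z ∷ bb , y) ∷ D₂)) → Unique (z ∷ bb) →
  x ∈ s (z ∷ bb) → All (_< x) (dropThrough x (sortBlocks (D₁ ++ (z ∷ bb , y) ∷ D₂))) → x ≡ maxL (z ∷ bb)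
dominant-∈-s⇒max D₁ z bb y D₂ {x} u ub x∈ dominant with s-ends-with-max z bb ub
... | w , sb≡ with ∈-++⁻ w (subst (x ∈_) sb≡ x∈)
...   | inj₂ (here x≡M) = x≡M
...   | inj₁ x∈w = ⊥-elim (<⇒≱ (All.lookup dominant M-after-x) (maxL-upper (z ∷ bb) (s-∈⁻ (z ∷ bb) x∈)))
  where
  M : ℕ
  M = maxL (z ∷ bb)
  L≡ : sortBlocks (D₁ ++ (z ∷ bb , y) ∷ D₂) ≡ (sortBlocks D₁ ++ w) ++ M ∷ sortBlocks D₂ ++ []
  L≡ = trans (sym (++-identityʳ _)) (sortBlocks-around D₁ (z ∷ bb) y D₂ [] sb≡)
  M-after-x : M ∈ dropThrough x (sortBlocks (D₁ ++ (z ∷ bb , y) ∷ D₂))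
  M-after-x = subst (λ L → M ∈ dropThrough x L) (sym L≡)
    (dropThrough-++-∈ (sortBlocks D₁ ++ w) (subst Unique L≡ u) (∈-++⁺ʳ (sortBlocks D₁) x∈w) (here refl))

findLeft-block : ∀ x D₁ z bb y D₂ → x ∉ flatten D₁ → maxL (z ∷ bb) ≡ x →
  findLeft x (D₁ ++ (z ∷ bb , y) ∷ D₂) ≡ y
findLeft-block x [] z bb y D₂ _ max≡x rewrite ≡ᵇ-reflexive max≡x = refl
findLeft-block x (([] , c) ∷ D₁) z bb y D₂ x∉ max≡x = findLeft-block x D₁ z bb y D₂ (x∉ ∘ there) max≡x
findLeft-block x ((z′ ∷ b′ , c) ∷ D₁) z bb y D₂ x∉ max≡x
  rewrite ≡ᵇ-false {maxL (z′ ∷ b′)} {x} (λ { refl → x∉ (∈-++⁺ˡ (maxL-∈ z′ b′)) })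
  = findLeft-block x D₁ z bb y D₂ (x∉ ∘ ∈-++⁺ʳ (z′ ∷ b′) ∘ there) max≡x

flatten-decompAux : ∀ f P → length P ≤ f → Unique P → flatten (decompAux f P) ≡ P
flatten-decompAux zero    []       _  _ = refl
flatten-decompAux (suc f) []       _  _ = refl
flatten-decompAux (suc f) (x ∷ xs) le u =
  trans (cong (λ l → before ++ m ∷ l) (flatten-decompAux f after (after-shorter le) unique-after)) (sym split)
  where open SplitAtMax x xs u

separators-decompAux-⊆ : ∀ f P {y} → y ∈ separators (decompAux f P) → y ∈ P
separators-decompAux-⊆ (suc f) (x ∷ xs) (here refl) = maxL-∈ x xs
separators-decompAux-⊆ (suc f) (x ∷ xs) (there y∈) =
  subst (_ ∈_) (sym (splitAtElem-∈ _ (x ∷ xs) (maxL-∈ x xs)))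
    (∈-++⁺ʳ _ (there (separators-decompAux-⊆ f _ y∈)))

separator-decompAux-dominates : ∀ f P {y} → Unique P → y ∈ separators (decompAux f P) → All (_< y) (dropThrough y P)
separator-decompAux-dominates (suc f) (x ∷ xs) u (here refl) =
  subst (All (_< m)) (sym (dropThrough-at before split u)) after<m
  where open SplitAtMax x xs u
separator-decompAux-dominates (suc f) (x ∷ xs) {y} u (there y∈) =
  subst (All (_< y)) (sym drop-prefix) (separator-decompAux-dominates f after unique-after y∈)
  where
  open SplitAtMax x xs u
  y∈after : y ∈ after
  y∈after = separators-decompAux-⊆ f after y∈
  drop-prefix : dropThrough y (x ∷ xs) ≡ dropThrough y after
  drop-prefix = begin
    dropThrough y (x ∷ xs)              ≡⟨ cong (dropThrough y) split ⟩
    dropThrough y (before ++ m ∷ after) ≡⟨ dropThrough-++ before (λ y∈b → Unique-++-disjoint before unique-split y∈b (there y∈after)) ⟩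
    dropThrough y (m ∷ after)           ≡⟨ dropThrough-∷-≢ after (λ { refl → Unique-∉-suffix before unique-split y∈after }) ⟩
    dropThrough y after                 ∎
    where open ≡-Reasoning

beforeZero-runStack : ∀ f P Q st → length P ≤ f → Unique P → All (0 <_) P → 0 <Top st → All (_<Top st) P →
  beforeZero (runStack (P ++ 0 ∷ Q) st) ≡ sortBlocks (decompAux f P)
beforeZero-runStack zero    []       Q st _  _ _   0<st _ = beforeZero-runStack-0 Q st 0<st
beforeZero-runStack (suc f) []       Q st _  _ _   0<st _ = beforeZero-runStack-0 Q st 0<st
beforeZero-runStack (suc f) (x ∷ xs) Q st le u P>0 0<st P<st = begin
  beforeZero (runStack ((x ∷ xs) ++ 0 ∷ Q) st)               ≡⟨ cong (λ l → beforeZero (runStack l st)) resplit ⟩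
  beforeZero (runStack (before ++ m ∷ after ++ 0 ∷ Q) st)     ≡⟨ cong beforeZero (runStack-flush before [] st before<m [] m<st) ⟩
  beforeZero (s before ++ runStack (after ++ 0 ∷ Q) (m ∷ st)) ≡⟨ beforeZero-++ (s before) s-before>0 ⟩
  s before ++ beforeZero (runStack (after ++ 0 ∷ Q) (m ∷ st)) ≡⟨ cong (s before ++_) rest ⟩
  s before ++ sortBlocks (decompAux f after)                  ∎
  where
  open SplitAtMax x xs u
  open ≡-Reasoning
  resplit : (x ∷ xs) ++ 0 ∷ Q ≡ before ++ m ∷ after ++ 0 ∷ Q
  resplit = trans (cong (_++ 0 ∷ Q) split) (++-assoc before (m ∷ after) (0 ∷ Q))
  m<st : m <Top st
  m<st = All.lookup P<st (maxL-∈ x xs)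
  s-before>0 : All (0 <_) (s before)
  s-before>0 = All.anti-mono (s-∈⁻ before) (All.anti-mono before-⊆ P>0)
  rest : beforeZero (runStack (after ++ 0 ∷ Q) (m ∷ st)) ≡ sortBlocks (decompAux f after)
  rest = beforeZero-runStack f after Q (m ∷ st) (after-shorter le) unique-after (All.anti-mono after-⊆ P>0)
    (All.lookup P>0 (maxL-∈ x xs)) after<m

-- Columns and rows of T_π

module _ (π : List ℕ) where

  searchCols-sound : ∀ x a f {a′ p} → searchCols π x a f ≡ just (a′ , p) →
    a ≤ a′ × a′ < a + f × findIdx x (Cseq π a′) ≡ just p
  searchCols-sound x a (suc f) e with findIdx x (Cseq π a) in found
  searchCols-sound x a (suc f) refl | just _ = ≤-refl , subst (a <_) (sym (+-suc a f)) (s≤s (m≤m+n a f)) , found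
  ... | nothing with searchCols-sound x (suc a) f e
  ...   | a<a′ , a′< , found′ = <⇒≤ a<a′ , ≤-trans a′< (≤-reflexive (sym (+-suc a f))) , found′

  searchCols-complete : ∀ x a f {a′} → x ∈ Cseq π a′ → a ≤ a′ → a′ < a + f → ∃ λ q → searchCols π x a f ≡ just q
  searchCols-complete x a zero    _  a≤a′ a′< = ⊥-elim (<⇒≱ a′< (subst (_≤ _) (sym (+-identityʳ a)) a≤a′))
  searchCols-complete x a (suc f) {a′} x∈ a≤a′ a′< with findIdx x (Cseq π a) in found
  ... | just p  = (a , p) , refl
  ... | nothing with m≤n⇒m<n∨m≡n a≤a′
  ...   | inj₁ a<a′ = searchCols-complete x (suc a) f x∈ a<a′ (subst (a′ <_) (+-suc a f) a′<)
  ...   | inj₂ refl with () ← trans (sym found) (proj₂ (findIdx-complete (Cseq π a) x∈))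

  colPair-cases : ∀ x → (colPair π x ≡ nothing × col π x ≡ 0 × colpos π x ≡ 0)
    ⊎ (∃ λ a → ∃ λ p → colPair π x ≡ just (a , p) × col π x ≡ a × colpos π x ≡ p)
  colPair-cases x with colPair π x
  ... | nothing      = inj₁ (refl , refl , refl)
  ... | just (a , p) = inj₂ (a , p , refl , refl , refl)

  col≡suc⇒ : ∀ x c → col π x ≡ suc c →
    x ∈ Cseq π (suc c) × suc c ≤ sc π × findIdx x (Cseq π (suc c)) ≡ just (colpos π x)
  col≡suc⇒ x c col≡ with colPair-cases x
  ... | inj₁ (_ , col≡0 , _) = ⊥-elim (0≢1+n (trans (sym col≡0) col≡))
  ... | inj₂ (a , p , e , refl , refl) with searchCols-sound x 1 (sc π) e
  ...   | _ , a< , found rewrite col≡ = findIdx-∈ (Cseq π (suc c)) found , s<s⁻¹ a< , found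

  col≡0⇒row≡0 : ∀ x → col π x ≡ 0 → row π x ≡ 0
  col≡0⇒row≡0 x col≡ with colPair-cases x
  ... | inj₁ (_ , _ , colpos≡0) = trans (cong (λ f → rowF π f x) col≡) colpos≡0
  ... | inj₂ (a , p , e , refl , _) with searchCols-sound x 1 (sc π) e
  ...   | 1≤a , _ rewrite col≡ with () ← 1≤a

  col≡1⇒row≡colpos : ∀ x → col π x ≡ 1 → row π x ≡ colpos π x
  col≡1⇒row≡colpos x col≡ = begin
    rowF π (col π x) x ≡⟨ cong (λ f → rowF π f x) col≡ ⟩
    rowF π 1 x         ≡⟨ cong (λ c → if c ≤ᵇ 1 then colpos π x else rowF π 0 (leftof π x)) col≡ ⟩
    colpos π x         ∎
    where open ≡-Reasoning

  row-via-leftof : ∀ x c → col π x ≡ suc (suc c) → col π (leftof π x) ≡ suc c → row π x ≡ row π (leftof π x)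
  row-via-leftof x c col≡ col-leftof≡ = begin
    rowF π (col π x) x          ≡⟨ cong (λ f → rowF π f x) col≡ ⟩
    rowF π (suc (suc c)) x      ≡⟨ cong (λ c′ → if c′ ≤ᵇ 1 then colpos π x else rowF π (suc c) (leftof π x)) col≡ ⟩
    rowF π (suc c) (leftof π x) ≡⟨ cong (λ f → rowF π f (leftof π x)) col-leftof≡ ⟨
    row π (leftof π x)          ∎
    where open ≡-Reasoning

module _ {n : ℕ} {π : List ℕ} (π∈S′ : InSn' n π) where

  σ : ℕ → List ℕ
  σ c = sIter c π

  σ-↭ : ∀ c → σ c ↭ upTo (suc n)
  σ-↭ zero    = proj₁ π∈S′
  σ-↭ (suc c) = ↭-trans (s-↭ (σ c)) (σ-↭ c)

  σ-unique : ∀ c → Unique (σ c)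
  σ-unique c = Unique-resp-↭ (setoid ℕ) (↭⇒↭ₛ (↭-sym (σ-↭ c))) (upTo⁺ (suc n))

  σ-≤ : ∀ c {y} → y ∈ σ c → y ≤ n
  σ-≤ c y∈ = s≤s⁻¹ (∈-upTo⁻ (∈-resp-↭ (σ-↭ c) y∈))

  left : ℕ → List ℕ
  left c = beforeZero (σ c)

  blocks : ℕ → Blocks
  blocks c = decomp π (suc c)

  σ-split : ∀ c → σ c ≡ left c ++ 0 ∷ afterZero (σ c)
  σ-split c = beforeZero-afterZero (σ c) (∈-resp-↭ (↭-sym (σ-↭ c)) (∈-upTo⁺ (s≤s z≤n)))

  left-unique : ∀ c → Unique (left c)
  left-unique c = Unique-++⁻ˡ (left c) (subst Unique (σ-split c) (σ-unique c))

  flatten-blocks : ∀ c → flatten (blocks c) ≡ left c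
  flatten-blocks c = flatten-decompAux (length (left c)) (left c) ≤-refl (left-unique c)

  blocks-unique : ∀ c → Unique (flatten (blocks c))
  blocks-unique c = subst Unique (sym (flatten-blocks c)) (left-unique c)

  left-suc : ∀ c → left (suc c) ≡ sortBlocks (blocks c)
  left-suc c = trans (cong (λ l → beforeZero (s l)) (σ-split c))
    (beforeZero-runStack (length (left c)) (left c) (afterZero (σ c)) [] ≤-refl (left-unique c)
      (beforeZero-positive (σ c)) tt (All.universal (λ _ → tt) (left c)))

  σ-blocks : ∀ c → σ c ≡ flatten (blocks c) ++ 0 ∷ afterZero (σ c)
  σ-blocks c = trans (σ-split c) (cong (_++ 0 ∷ afterZero (σ c)) (sym (flatten-blocks c)))

  σ-suc-blocks : ∀ c → σ (suc c) ≡ sortBlocks (blocks c) ++ 0 ∷ afterZero (σ (suc c))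
  σ-suc-blocks c = trans (σ-split (suc c)) (cong (_++ 0 ∷ afterZero (σ (suc c))) (left-suc c))

  Cseq-⊆-left : ∀ c {y} → y ∈ Cseq π (suc c) → y ∈ left c
  Cseq-⊆-left c y∈ = subst (_ ∈_) (flatten-blocks c) (separators-⊆-flatten (blocks c) y∈)

  left-suc-⊆ : ∀ c {y} → y ∈ left (suc c) → y ∈ left c
  left-suc-⊆ c y∈ =
    subst (_ ∈_) (flatten-blocks c) (sortBlocks-⊆-flatten (blocks c) (subst (_ ∈_) (left-suc c) y∈))

  left-antitone : ∀ {c} c′ → c ≤ c′ → ∀ {y} → y ∈ left c′ → y ∈ left c
  left-antitone zero     z≤n y∈ = y∈
  left-antitone (suc c′) c≤  y∈ with m≤n⇒m<n∨m≡n c≤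
  ... | inj₂ refl = y∈
  ... | inj₁ c<   = left-antitone c′ (s≤s⁻¹ c<) (left-suc-⊆ c′ y∈)

  Cseq-∉-left-suc : ∀ c {y} → y ∈ Cseq π (suc c) → y ∉ left (suc c)
  Cseq-∉-left-suc c y∈ y∈left =
    separators-∉-sortBlocks (blocks c) (blocks-unique c) y∈ (subst (_ ∈_) (left-suc c) y∈left)

  Cseq-disjoint : ∀ c c′ {y} → y ∈ Cseq π (suc c) → y ∈ Cseq π (suc c′) → c ≡ c′
  Cseq-disjoint c c′ y∈ y∈′ with <-cmp c c′
  ... | tri≈ _ c≡c′ _ = c≡c′
  ... | tri< c<c′ _ _ = ⊥-elim (Cseq-∉-left-suc c  y∈  (left-antitone c′ c<c′ (Cseq-⊆-left c′ y∈′)))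
  ... | tri> _ _ c′<c = ⊥-elim (Cseq-∉-left-suc c′ y∈′ (left-antitone c  c′<c (Cseq-⊆-left c  y∈)))

  Cseq-range : ∀ c {y} → y ∈ Cseq π (suc c) → 1 ≤ y × y ≤ n
  Cseq-range c y∈ =
    All.lookup (beforeZero-positive (σ c)) (Cseq-⊆-left c y∈) , σ-≤ c (beforeZero-⊆ (σ c) (Cseq-⊆-left c y∈))

  ∈Cseq⇒col : ∀ x c → x ∈ Cseq π (suc c) → suc c ≤ sc π → col π x ≡ suc c
  ∈Cseq⇒col x c x∈ c<sc with searchCols-complete π x 1 (sc π) x∈ (s≤s z≤n) (s≤s c<sc)
  ... | (a , p) , e with searchCols-sound π x 1 (sc π) e | colPair-cases π x
  ...   | _ , _ , found | inj₁ (e′ , _) with () ← trans (sym e) e′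
  ...   | s≤s {n = a′} _ , _ , found | inj₂ (_ , _ , e′ , col≡ , _) with trans (sym e) e′
  ...     | refl = trans col≡ (cong suc (Cseq-disjoint a′ c (findIdx-∈ (Cseq π (suc a′)) found) x∈))

  separator-is-block-max : ∀ c {x} → x ∈ Cseq π (suc (suc c)) →
    ∃ λ D₁ → ∃ λ z → ∃ λ bb → ∃ λ y → ∃ λ D₂ → blocks c ≡ D₁ ++ (z ∷ bb , y) ∷ D₂ × maxL (z ∷ bb) ≡ x
  separator-is-block-max c {x} x∈ with ∈-sortBlocks⁻ (blocks c) (subst (x ∈_) (left-suc c) (Cseq-⊆-left (suc c) x∈))
  ... | D₁ , z ∷ bb , y , D₂ , blocks≡ , x∈sb = D₁ , z , bb , y , D₂ , blocks≡ , sym (dominant-∈-s⇒max D₁ z bb y D₂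
          (subst Unique sortBlocks≡ (left-unique (suc c)))
          (Unique-block D₁ (z ∷ bb) y D₂ (subst (Unique ∘ flatten) blocks≡ (blocks-unique c)))
          x∈sb
          (subst (λ l → All (_< x) (dropThrough x l)) sortBlocks≡
            (separator-decompAux-dominates (length (left (suc c))) (left (suc c)) (left-unique (suc c)) x∈)))
    where
    sortBlocks≡ : left (suc c) ≡ sortBlocks (D₁ ++ (z ∷ bb , y) ∷ D₂)
    sortBlocks≡ = trans (left-suc c) (cong sortBlocks blocks≡)

  leftof-block : ∀ x c → col π x ≡ suc (suc c) →
    ∃ λ D₁ → ∃ λ z → ∃ λ bb → ∃ λ D₂ → blocks c ≡ D₁ ++ (z ∷ bb , leftof π x) ∷ D₂ × maxL (z ∷ bb) ≡ x
  leftof-block x c col≡ with separator-is-block-max c (proj₁ (col≡suc⇒ π x (suc c) col≡))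
  ... | D₁ , z , bb , y , D₂ , blocks≡ , max≡x =
    D₁ , z , bb , D₂ , subst (λ l → blocks c ≡ D₁ ++ (z ∷ bb , l) ∷ D₂) (sym leftof≡y) blocks≡ , max≡x
    where
    x∉D₁ : x ∉ flatten D₁
    x∉D₁ x∈ = Unique-++-disjoint (flatten D₁)
      (subst Unique (trans (cong flatten blocks≡) (flatten-++ D₁ _)) (blocks-unique c))
      x∈ (∈-++⁺ˡ (subst (_∈ z ∷ bb) max≡x (maxL-∈ z bb)))
    leftof≡y : leftof π x ≡ y
    leftof≡y = trans (cong (λ i → findLeft x (decomp π (i ∸ 1))) col≡)
      (trans (cong (findLeft x) blocks≡) (findLeft-block x D₁ z bb y D₂ x∉D₁ max≡x))

  col-leftof : ∀ x c → col π x ≡ suc (suc c) → col π (leftof π x) ≡ suc c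
  col-leftof x c col≡ with leftof-block x c col≡
  ... | D₁ , z , bb , D₂ , blocks≡ , _ = ∈Cseq⇒col (leftof π x) c
    (subst (leftof π x ∈_) (cong separators (sym blocks≡)) (∈-separators-middle D₁ (z ∷ bb) (leftof π x) D₂))
    (<⇒≤ (proj₁ (proj₂ (col≡suc⇒ π x (suc c) col≡))))

  row-leftof : ∀ x c → col π x ≡ suc (suc c) → row π x ≡ row π (leftof π x)
  row-leftof x c col≡ = row-via-leftof π x c col≡ (col-leftof x c col≡)

  row-injective : ∀ a x x′ → col π x ≡ suc a → col π x′ ≡ suc a → row π x ≡ row π x′ → x ≡ x′
  row-injective zero x x′ col≡ col≡′ row≡ =
    findIdx-injective (Cseq π 1) (proj₂ (proj₂ (col≡suc⇒ π x 0 col≡)))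
      (trans (proj₂ (proj₂ (col≡suc⇒ π x′ 0 col≡′))) (cong just (sym colpos≡)))
    where
    colpos≡ : colpos π x ≡ colpos π x′
    colpos≡ = trans (sym (col≡1⇒row≡colpos π x col≡)) (trans row≡ (col≡1⇒row≡colpos π x′ col≡′))
  row-injective (suc a) x x′ col≡ col≡′ row≡ with leftof-block x a col≡ | leftof-block x′ a col≡′
  ... | D₁ , z , bb , D₂ , blocks≡ , max≡ | D₁′ , z′ , bb′ , D₂′ , blocks≡′ , max≡′ =
    trans (sym max≡) (trans (cong maxL block≡) max≡′)
    where
    leftof≡ : leftof π x ≡ leftof π x′
    leftof≡ = row-injective a (leftof π x) (leftof π x′) (col-leftof x a col≡) (col-leftof x′ a col≡′)
      (trans (sym (row-leftof x a col≡)) (trans row≡ (row-leftof x′ a col≡′)))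
    block≡ : z ∷ bb ≡ z′ ∷ bb′
    block≡ = block-unique D₁ D₁′ (subst (Unique ∘ flatten) blocks≡ (blocks-unique a))
      (trans (sym blocks≡) (trans blocks≡′ (cong (λ l → D₁′ ++ (z′ ∷ bb′ , l) ∷ D₂′) (sym leftof≡))))

  s-block-ends-with-successor : ∀ c {X₁ X₂} → col π X₁ ≡ suc c → col π X₂ ≡ suc (suc c) → row π X₁ ≡ row π X₂ →
    ∀ D₁ b D₂ → blocks c ≡ D₁ ++ (b , X₁) ∷ D₂ → ∃ λ w → s b ≡ w ++ X₂ ∷ []
  s-block-ends-with-successor c {X₁} {X₂} col₁ col₂ row≡ D₁ b D₂ blocks≡ with leftof-block X₂ c col₂
  ... | D₁′ , z , bb , D₂′ , blocks≡′ , max≡ =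
    s-block-ends-with b (Unique-block D₁ b X₁ D₂ unique-blocks) (z , bb , block≡ , trans (cong maxL block≡) max≡)
    where
    unique-blocks : Unique (flatten (D₁ ++ (b , X₁) ∷ D₂))
    unique-blocks = subst (Unique ∘ flatten) blocks≡ (blocks-unique c)
    leftof≡ : leftof π X₂ ≡ X₁
    leftof≡ = row-injective c (leftof π X₂) X₁ (col-leftof X₂ c col₂) col₁ (trans (sym (row-leftof X₂ c col₂)) (sym row≡))
    block≡ : b ≡ z ∷ bb
    block≡ = block-unique D₁ D₁′ unique-blocks
      (trans (sym blocks≡) (trans blocks≡′ (cong (λ l → D₁′ ++ (z ∷ bb , l) ∷ D₂′) leftof≡)))

  row-range : ∀ a x → col π x ≡ suc a → 1 ≤ row π x × row π x ≤ length (Cseq π 1)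
  row-range zero x col≡ = subst (λ r → 1 ≤ r × r ≤ length (Cseq π 1)) (sym (col≡1⇒row≡colpos π x col≡))
    (findIdx-range (Cseq π 1) (proj₂ (proj₂ (col≡suc⇒ π x 0 col≡))))
  row-range (suc a) x col≡ = subst (λ r → 1 ≤ r × r ≤ length (Cseq π 1)) (sym (row-leftof x a col≡))
    (row-range a (leftof π x) (col-leftof x a col≡))

  descend : ∀ d a x → col π x ≡ suc (d + a) → ∃ λ x′ → col π x′ ≡ suc a × row π x′ ≡ row π x
  descend zero    a x col≡ = x , col≡ , refl
  descend (suc d) a x col≡ with descend d a (leftof π x) (col-leftof x (d + a) col≡)
  ... | x′ , col≡′ , row≡′ = x′ , col≡′ , trans row≡′ (sym (row-leftof x (d + a) col≡))

  row-order : ∀ a x x′ → col π x ≡ suc a → col π x′ ≡ suc a → row π x < row π x′ → x′ ∈ dropThrough x (Cseq π (suc a))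
  row-order zero x x′ col≡ col≡′ row< =
    findIdx-< (Cseq π 1) (proj₂ (proj₂ (col≡suc⇒ π x 0 col≡))) (proj₂ (proj₂ (col≡suc⇒ π x′ 0 col≡′)))
      (subst₂ _<_ (col≡1⇒row≡colpos π x col≡) (col≡1⇒row≡colpos π x′ col≡′) row<)
  row-order (suc c) x x′ col≡ col≡′ row< =
    step (separators-order⁻ (blocks c) (blocks-unique c) (proj₁ (col≡suc⇒ π (leftof π x) c (col-leftof x c col≡)))
        (row-order c (leftof π x) (leftof π x′) (col-leftof x c col≡) (col-leftof x′ c col≡′)
          (subst₂ _<_ (row-leftof x c col≡) (row-leftof x′ c col≡′) row<)))
    where
    step : (∃ λ E₁ → ∃ λ b → ∃ λ M → ∃ λ b′ → ∃ λ E₂ → blocks c ≡ E₁ ++ (b , leftof π x) ∷ M ++ (b′ , leftof π x′) ∷ E₂) →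
      x′ ∈ dropThrough x (Cseq π (suc (suc c)))
    step (E₁ , b , M , b′ , E₂ , blocks≡) =
      separators-order⁺ (blocks (suc c)) (blocks-unique (suc c)) (proj₁ (col≡suc⇒ π x (suc c) col≡))
        (proj₁ (col≡suc⇒ π x′ (suc c) col≡′)) (subst (λ l → x′ ∈ dropThrough x l) (sym (flatten-blocks (suc c))) x′-after-x)
      where
      lx lx′ : ℕ
      lx = leftof π x
      lx′ = leftof π x′
      x∈sb : x ∈ s b
      x∈sb = ends-∈ (s-block-ends-with-successor c (col-leftof x c col≡) col≡ (sym (row-leftof x c col≡))
        E₁ b (M ++ (b′ , lx′) ∷ E₂) blocks≡)
      x′∈sb′ : x′ ∈ s b′
      x′∈sb′ = ends-∈ (s-block-ends-with-successor c (col-leftof x′ c col≡′) col≡′ (sym (row-leftof x′ c col≡′))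
        (E₁ ++ (b , lx) ∷ M) b′ E₂ (trans blocks≡ (sym (++-assoc E₁ ((b , lx) ∷ M) ((b′ , lx′) ∷ E₂)))))
      left≡ : left (suc c) ≡ sortBlocks (E₁ ++ (b , lx) ∷ []) ++ sortBlocks (M ++ (b′ , lx′) ∷ E₂)
      left≡ = trans (left-suc c) (trans (cong sortBlocks (trans blocks≡ (sym (++-assoc E₁ ((b , lx) ∷ []) _))))
        (sortBlocks-++ (E₁ ++ (b , lx) ∷ []) _))
      x′-after-x : x′ ∈ dropThrough x (left (suc c))
      x′-after-x = subst (λ l → x′ ∈ dropThrough x l) (sym left≡)
        (dropThrough-++-∈ (sortBlocks (E₁ ++ (b , lx) ∷ [])) (subst Unique left≡ (left-unique (suc c)))
          (∈-sortBlocks-middle E₁ b lx [] x∈sb) (∈-sortBlocks-middle M b′ lx′ E₂ x′∈sb′))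

  rowMembers : ℕ → List ℕ
  rowMembers j = filter (λ x → row π x ≟ j) (range1 n)

  α : List ℕ
  α = alphaπ n π

  length-α : length α ≡ length (Cseq π 1)
  length-α = trans (length-map _ (range1 (length (Cseq π 1)))) (length-range1 _)

  alphaAt-α : ∀ j → 1 ≤ j → j ≤ length (Cseq π 1) → alphaAt α j ≡ length (rowMembers j)
  alphaAt-α j = alphaAt-map-range1 (length ∘ rowMembers) (length (Cseq π 1)) j

  col⇒∈range1 : ∀ a x → col π x ≡ suc a → x ∈ range1 n
  col⇒∈range1 a x col≡ = let (1≤x , x≤n) = Cseq-range a (proj₁ (col≡suc⇒ π x a col≡)) in range1-∈⁺ n 1≤x x≤n

  row-positive⇒col : ∀ x → 1 ≤ row π x → ∃ λ a → col π x ≡ suc a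
  row-positive⇒col x 1≤row = pred (col π x) , sym (suc-pred (col π x) {{≢-nonZero col≢0}})
    where
    col≢0 : col π x ≢ 0
    col≢0 col≡0 = <⇒≱ 1≤row (≤-reflexive (col≡0⇒row≡0 π x col≡0))

  ∈rowMembers : ∀ a x → col π x ≡ suc a → x ∈ rowMembers (row π x)
  ∈rowMembers a x col≡ = ∈-filter⁺ (λ x′ → row π x′ ≟ row π x) (col⇒∈range1 a x col≡) refl

  rowMembers-length-≥ : ∀ a y → col π y ≡ suc a → suc a ≤ length (rowMembers (row π y))
  rowMembers-length-≥ a y col≡ = subst (_≤ length (rowMembers (row π y))) (length-range1 (suc a))
    (injection-length-≤ {R = λ u v → col π v ≡ u} (range1 (suc a)) (rowMembers (row π y)) (Unique-range1 (suc a))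
      cell-in-column (λ _ _ col≡u col≡u′ → trans (sym col≡u) col≡u′))
    where
    cell-in-column : ∀ {u} → u ∈ range1 (suc a) → ∃ λ v → v ∈ rowMembers (row π y) × col π v ≡ u
    cell-in-column u∈ with range1-∈⁻ (suc a) u∈
    cell-in-column {suc u} _ | _ , u≤a with descend (a ∸ u) u y (trans col≡ (cong suc (sym (m∸n+n≡m (s≤s⁻¹ u≤a)))))
    ... | v , col≡′ , row≡ = v , subst (λ r → v ∈ rowMembers r) row≡ (∈rowMembers u v col≡′) , col≡′

  rowMembers-length-≤ : ∀ a j → 1 ≤ j → All (λ x → col π x ≤ a) (rowMembers j) → length (rowMembers j) ≤ a
  rowMembers-length-≤ a j 1≤j cols≤a = subst (length (rowMembers j) ≤_) (length-range1 a)
    (injection-length-≤ {R = λ x v → col π x ≡ v} (rowMembers j) (range1 a)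
      (filter⁺ (λ x → row π x ≟ j) (Unique-range1 n)) col-in-range col-injective)
    where
    col-positive : ∀ {x} → x ∈ rowMembers j → ∃ λ b → col π x ≡ suc b
    col-positive x∈ = row-positive⇒col _ (subst (1 ≤_) (sym (proj₂ (∈-filter⁻ (λ x → row π x ≟ j) {xs = range1 n} x∈))) 1≤j)
    col-in-range : ∀ {x} → x ∈ rowMembers j → ∃ λ v → v ∈ range1 a × col π x ≡ v
    col-in-range {x} x∈ =
      col π x , range1-∈⁺ a (subst (1 ≤_) (sym (proj₂ (col-positive x∈))) (s≤s z≤n)) (All.lookup cols≤a x∈) , refl
    col-injective : ∀ {x x′ v} → x ∈ rowMembers j → x′ ∈ rowMembers j → col π x ≡ v → col π x′ ≡ v → x ≡ x′
    col-injective {x} {x′} x∈ x′∈ col≡ col≡′ =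
      row-injective _ x x′ (proj₂ (col-positive x∈)) (trans col≡′ (trans (sym col≡) (proj₂ (col-positive x∈))))
        (trans (row≡j x∈) (sym (row≡j x′∈)))
      where
      row≡j : ∀ {x} → x ∈ rowMembers j → row π x ≡ j
      row≡j x∈ = proj₂ (∈-filter⁻ (λ x → row π x ≟ j) {xs = range1 n} x∈)

  cell-exists : ∀ a j → 1 ≤ j → suc a ≤ length (rowMembers j) → ∃ λ x → col π x ≡ suc a × row π x ≡ j
  cell-exists a j 1≤j a<size with any? (λ x → suc a ≤? col π x) (rowMembers j)
  ... | no none  = ⊥-elim (<⇒≱ a<size (rowMembers-length-≤ a j 1≤j
                     (All.map (s≤s⁻¹ ∘ ≰⇒>) (¬Any⇒All¬ (rowMembers j) none))))
  ... | yes some with find some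
  ...   | x , x∈ , a<col with descend (col π x ∸ suc a) a x (trans (sym (m∸n+n≡m a<col)) (+-suc (col π x ∸ suc a) a))
  ...     | x′ , col≡ , row≡ = x′ , col≡ , trans row≡ (proj₂ (∈-filter⁻ (λ x → row π x ≟ j) {xs = range1 n} x∈))

  T⁻¹ : ℕ → ℕ → ℕ
  T⁻¹ a v = Tinv n (Tπ π) (a , v)

  Occupied : ℕ → ℕ → Set
  Occupied a v = col π (T⁻¹ a v) ≡ a × row π (T⁻¹ a v) ≡ v

  findInv-spec : ∀ a b l → (∃ λ x → x ∈ l × col π x ≡ a × row π x ≡ b) →
    col π (findInv (Tπ π) a b l) ≡ a × row π (findInv (Tπ π) a b l) ≡ b
  findInv-spec a b (x ∷ l) (y , y∈ , col≡ , row≡) with (col π x ≡ᵇ a) ∧ (row π x ≡ᵇ b) in match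
  ... | true  = let (c , r) = Equivalence.to T-∧ (Equivalence.from T-≡ match) in ≡ᵇ⇒≡ _ _ c , ≡ᵇ⇒≡ _ _ r
  ... | false with y∈
  ...   | there y∈l = findInv-spec a b l (y , y∈l , col≡ , row≡)
  ...   | here refl with () ← trans (sym match) (cong₂ _∧_ (≡ᵇ-reflexive col≡) (≡ᵇ-reflexive row≡))

  Tinv-cell : ∀ a b → 1 ≤ b → suc a ≤ length (rowMembers b) → Occupied (suc a) b
  Tinv-cell a b 1≤b a<size with cell-exists a b 1≤b a<size
  ... | x , col≡ , row≡ = findInv-spec (suc a) b (range1 n) (x , col⇒∈range1 a x col≡ , col≡ , row≡)

  Tinv-T : ∀ a y → col π y ≡ suc a → T⁻¹ (suc a) (row π y) ≡ y
  Tinv-T a y col≡ with findInv-spec (suc a) (row π y) (range1 n) (y , col⇒∈range1 a y col≡ , col≡ , refl)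
  ... | col≡′ , row≡ = row-injective a _ y col≡′ col≡ row≡

  -- The segments B(i, j, k)

  Window : ℕ → List ℕ → List ℕ → Set
  Window c B B′ = ∃ λ W → B ≡ flatten W × B′ ≡ sortBlocks W × (∀ {y} → y ∈ separators W → y ∈ Cseq π (suc c))

  window : ∀ c E M b X₁ F {w X₂ start start′} → blocks c ≡ E ++ M ++ (b , X₁) ∷ F → s b ≡ w ++ X₂ ∷ [] →
    start ≡ flatten (M ++ (b , X₁) ∷ F) ++ 0 ∷ afterZero (σ c) → Unique start →
    start′ ≡ sortBlocks (M ++ (b , X₁) ∷ F) ++ 0 ∷ afterZero (σ (suc c)) → Unique start′ →
    Window c (takeThrough X₁ start) (takeThrough X₂ start′)
  window c E M b X₁ F blocks≡ sb≡ refl u refl u′ =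
    M ++ (b , X₁) ∷ [] , takeThrough-flatten M b X₁ F _ u , takeThrough-sortBlocks M b X₁ F _ sb≡ u′ ,
    λ y∈ → subst (λ D → _ ∈ separators D) (sym blocks≡) (separators-window-⊆ E M b X₁ F y∈)

  window-step : ∀ c {B B′} → Window c B B′ →
    (∀ {y} → y ∈ B′ → y ∈ B) × (∀ {y} → y ∈ B → y ∉ B′ → y ∈ Cseq π (suc c))
  window-step c (W , refl , refl , sep⊆) =
    sortBlocks-⊆-flatten W , λ y∈ y∉ → sep⊆ (flatten-∖-sortBlocks W y∈ y∉)

  -- B α (Tπ π) n π i j k is segment (rAux α i (j ∸ 1)) j k by definition.
  segment : ℕ → ℕ → ℕ → List ℕ
  segment r j k = takeThrough (T⁻¹ k j) (if r ≡ᵇ 0 then σ (k ∸ 1) else dropThrough (T⁻¹ k r) (σ (k ∸ 1)))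

  window-top : ∀ c j → Occupied (suc c) j → Occupied (suc (suc c)) j →
    Window c (segment 0 j (suc c)) (segment 0 j (suc (suc c)))
  window-top c j (col₁ , row₁) (col₂ , row₂) = top (∈-separators⁻ (blocks c) (proj₁ (col≡suc⇒ π X₁ c col₁)))
    where
    X₁ X₂ : ℕ
    X₁ = T⁻¹ (suc c) j
    X₂ = T⁻¹ (suc (suc c)) j
    top : (∃ λ D₁ → ∃ λ b → ∃ λ D₂ → blocks c ≡ D₁ ++ (b , X₁) ∷ D₂) →
      Window c (takeThrough X₁ (σ c)) (takeThrough X₂ (σ (suc c)))
    top (D₁ , b , D₂ , blocks≡) =
      window c [] D₁ b X₁ D₂ blocks≡
        (proj₂ (s-block-ends-with-successor c col₁ col₂ (trans row₁ (sym row₂)) D₁ b D₂ blocks≡))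
        (trans (σ-blocks c) (cong (λ D → flatten D ++ _) blocks≡)) (σ-unique c)
        (trans (σ-suc-blocks c) (cong (λ D → sortBlocks D ++ _) blocks≡)) (σ-unique (suc c))

  window-mid : ∀ c j r → Occupied (suc c) j → Occupied (suc (suc c)) j →
    Occupied (suc c) (suc r) → Occupied (suc (suc c)) (suc r) → suc r < j →
    Window c (segment (suc r) j (suc c)) (segment (suc r) j (suc (suc c)))
  window-mid c j r (colX₁ , rowX₁) (colX₂ , rowX₂) (colR₁ , rowR₁) (colR₂ , rowR₂) r<j =
    mid (separators-order⁻ (blocks c) (blocks-unique c) (proj₁ (col≡suc⇒ π R₁ c colR₁))
          (row-order c R₁ X₁ colR₁ colX₁ (subst₂ _<_ (sym rowR₁) (sym rowX₁) r<j)))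
    where
    X₁ X₂ R₁ R₂ : ℕ
    X₁ = T⁻¹ (suc c) j
    X₂ = T⁻¹ (suc (suc c)) j
    R₁ = T⁻¹ (suc c) (suc r)
    R₂ = T⁻¹ (suc (suc c)) (suc r)
    mid : (∃ λ E₁ → ∃ λ bR → ∃ λ M → ∃ λ b → ∃ λ F → blocks c ≡ E₁ ++ (bR , R₁) ∷ M ++ (b , X₁) ∷ F) →
      Window c (takeThrough X₁ (dropThrough R₁ (σ c))) (takeThrough X₂ (dropThrough R₂ (σ (suc c))))
    mid (E₁ , bR , M , b , F , blocks≡) =
      window c (E₁ ++ (bR , R₁) ∷ []) M b X₁ F (trans blocks≡ (sym (++-assoc E₁ _ _))) (proj₂ sb-ends)
        (trans (cong (dropThrough R₁) σ≡) (dropThrough-flatten E₁ bR R₁ _ _ (subst Unique σ≡ (σ-unique c))))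
        (Unique-dropThrough (σ c) (σ-unique c))
        (trans (cong (dropThrough R₂) σ′≡)
          (dropThrough-sortBlocks E₁ bR R₁ _ _ (proj₂ sbR-ends) (subst Unique σ′≡ (σ-unique (suc c)))))
        (Unique-dropThrough (σ (suc c)) (σ-unique (suc c)))
      where
      σ≡ : σ c ≡ flatten (E₁ ++ (bR , R₁) ∷ M ++ (b , X₁) ∷ F) ++ 0 ∷ afterZero (σ c)
      σ≡ = trans (σ-blocks c) (cong (λ D → flatten D ++ _) blocks≡)
      σ′≡ : σ (suc c) ≡ sortBlocks (E₁ ++ (bR , R₁) ∷ M ++ (b , X₁) ∷ F) ++ 0 ∷ afterZero (σ (suc c))
      σ′≡ = trans (σ-suc-blocks c) (cong (λ D → sortBlocks D ++ _) blocks≡)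
      sbR-ends : ∃ λ w → s bR ≡ w ++ R₂ ∷ []
      sbR-ends = s-block-ends-with-successor c colR₁ colR₂ (trans rowR₁ (sym rowR₂)) E₁ bR _ blocks≡
      sb-ends : ∃ λ w → s b ≡ w ++ X₂ ∷ []
      sb-ends = s-block-ends-with-successor c colX₁ colX₂ (trans rowX₁ (sym rowX₂)) (E₁ ++ (bR , R₁) ∷ M) b F
        (trans blocks≡ (sym (++-assoc E₁ ((bR , R₁) ∷ M) ((b , X₁) ∷ F))))

  OccupiedBelow : ℕ → ℕ → Set
  OccupiedBelow K v = ∀ a → a < K → Occupied (suc a) v

  StartRow : ℕ → ℕ → ℕ → Set
  StartRow K j r = r ≡ 0 ⊎ (1 ≤ r × r < j × OccupiedBelow K r)

  segment-window : ∀ K j r → OccupiedBelow K j → StartRow K j r → ∀ c → suc (suc c) ≤ K →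
    Window c (segment r j (suc c)) (segment r j (suc (suc c)))
  segment-window K j .0 occ (inj₁ refl) c c<K = window-top c j (occ c (<-trans (n<1+n _) c<K)) (occ (suc c) c<K)
  segment-window K j (suc r) occ (inj₂ (_ , r<j , occR)) c c<K =
    window-mid c j r (occ c (<-trans (n<1+n _) c<K)) (occ (suc c) c<K)
      (occR c (<-trans (n<1+n _) c<K)) (occR (suc c) c<K) r<j

  segment-chain : ∀ K j r → OccupiedBelow K j → StartRow K j r → ∀ c → suc c ≤ K →
    (∀ {y} → y ∈ segment r j (suc c) → y ∈ segment r j 1) ×
    (∀ {y} → y ∈ segment r j 1 → y ∉ segment r j (suc c) → ∃ λ c′ → c′ < c × y ∈ Cseq π (suc c′))
  segment-chain K j r occ start zero    _   = (λ y∈ → y∈) , λ y∈ y∉ → ⊥-elim (y∉ y∈)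
  segment-chain K j r occ start (suc c) c<K
    with segment-chain K j r occ start c (<⇒≤ c<K) | window-step c (segment-window K j r occ start c c<K)
  ... | ⊆₁ , ∖₁ | ⊆′ , ∖′ = ⊆₁ ∘ ⊆′ , diff
    where
    diff : ∀ {y} → y ∈ segment r j 1 → y ∉ segment r j (suc (suc c)) → ∃ λ c′ → c′ < suc c × y ∈ Cseq π (suc c′)
    diff {y} y∈ y∉ with y ∈? segment r j (suc c)
    ... | yes y∈c = c , ≤-refl , ∖′ y∈c y∉
    ... | no  y∉c = let (c′ , c′<c , y∈C) = ∖₁ y∈ y∉c in c′ , m≤n⇒m≤1+n c′<c , y∈C

  occupied : ∀ a v → 1 ≤ v → v ≤ length α → suc a ≤ alphaAt α v → Occupied (suc a) v
  occupied a v 1≤v v≤ a<α =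
    Tinv-cell a v 1≤v (subst (suc a ≤_) (alphaAt-α v 1≤v (subst (v ≤_) length-α v≤)) a<α)

  occupied-row : ∀ {i j k} → InD α (i , j) → k < i → OccupiedBelow k j
  occupied-row (1≤j , j≤m , _ , i≤αj) k<i a a<k =
    occupied a _ 1≤j j≤m (≤-trans a<k (≤-trans (<⇒≤ k<i) i≤αj))

  rAux-startRow : ∀ {i j k} → InD α (i , j) → k < i → StartRow k j (rAux α i (j ∸ 1))
  rAux-startRow {suc i} {suc j} (1≤j , j≤m , _ , _) k≤i with rAux-spec α (suc i) j
  ... | inj₁ r≡0               = inj₁ r≡0
  ... | inj₂ (1≤r , r≤j , i≤αr) = inj₂ (1≤r , s≤s r≤j , λ a a<k →
          occupied a _ 1≤r (≤-trans (m≤n⇒m≤1+n r≤j) j≤m) (≤-trans a<k (≤-trans (s≤s⁻¹ k≤i) i≤αr)))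

  Cseq⇒cell : ∀ c y → y ∈ Cseq π (suc c) → suc c ≤ sc π →
    InD α (suc c , row π y) × y ≡ T⁻¹ (suc c) (row π y)
  Cseq⇒cell c y y∈ c<sc =
    (1≤row , subst (row π y ≤_) (sym length-α) row≤ , s≤s z≤n ,
      subst (suc c ≤_) (sym (alphaAt-α (row π y) 1≤row row≤)) (rowMembers-length-≥ c y col≡)) ,
    sym (Tinv-T c y col≡)
    where
    col≡ : col π y ≡ suc c
    col≡ = ∈Cseq⇒col y c y∈ c<sc
    1≤row : 1 ≤ row π y
    1≤row = proj₁ (row-range c y col≡)
    row≤ : row π y ≤ length (Cseq π 1)
    row≤ = proj₂ (row-range c y col≡)

  earlier-column⇒cell : ∀ c j {y} → Occupied (suc c) j → (∃ λ c′ → c′ < c × y ∈ Cseq π (suc c′)) →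
    ∃ λ i′ → ∃ λ j′ → InD α (i′ , j′) × i′ < suc c × y ≡ T⁻¹ i′ j′
  earlier-column⇒cell c j {y} (col≡ , _) (c′ , c′<c , y∈) =
    let (y∈D , y≡) = Cseq⇒cell c′ y y∈ (≤-trans (s≤s (<⇒≤ c′<c)) (proj₁ (proj₂ (col≡suc⇒ π _ c col≡))))
    in suc c′ , row π y , y∈D , s≤s c′<c , y≡

lemma4p4 : (n : ℕ) (π : List ℕ) → InSn' n π → (i j k : ℕ) →
  InD (alphaπ n π) (i , j) → 1 ≤ k → k < i →
  ((y : ℕ) → y ∈ B (alphaπ n π) (Tπ π) n π i j k → y ∈ B (alphaπ n π) (Tπ π) n π i j 1)
  × ((y : ℕ) → y ∈ B (alphaπ n π) (Tπ π) n π i j 1 → ¬ (y ∈ B (alphaπ n π) (Tπ π) n π i j k) →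
      ∃ (λ i′ → ∃ (λ j′ → InD (alphaπ n π) (i′ , j′) × (i′ < k) × (y ≡ Tinv n (Tπ π) (i′ , j′)))))
lemma4p4 n π π∈S′ i j (suc c) ij∈D _ k<i =
  let occupied-j = occupied-row π∈S′ ij∈D k<i
      (shrinks , removed) = segment-chain π∈S′ (suc c) j _ occupied-j (rAux-startRow π∈S′ ij∈D k<i) c ≤-refl
  in (λ _ → shrinks) , (λ _ y∈ y∉ → earlier-column⇒cell π∈S′ c j (occupied-j c ≤-refl) (removed y∈ y∉))
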